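{- Let $n\ge1$, $A\in\mathrm{Int}(n)$ and $x=\Gamma(A)$. Then (i) $\mathrm{zeros}(x)$ equals the sum of the entries in the first row of $A$; (ii) $\mathrm{last}(x)=\mathrm{index}(A)-1$; (iii) $\mathrm{asc}(x)=\dim(A)-1$; (iv) $\mathrm{rmax}(\hat x)$ equals the sum of the entries of the last column (column $\dim(A)$) of $A$; (v) $\mathrm{comp}(\hat x)=\mathrm{blocks}(A)$; (vi) $\sum_{i=1}^{n} q^{\hat x_i}=\sum_{i=1}^{\dim(A)} q^{r_i(A)}$, where $r_i(A)$ is the sum of the entries of row $i$ of $A$; (vii) $\sum_{i:\ \hat x_i \text{ is a right-to-left maximum of }\hat x} q^{\hat x_i}=\sum_{i=1}^{\dim(A)}A_{i,\dim(A)}\,q^{i-1}$ (identities (vi), (vii) as polynomials in $q$).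
   Context: $\mathrm{Int}(n)$ is the set of upper triangular square matrices with non-negative integer entries summing to $n$ such that every row and column has a non-zero entry. For such $A$: $\dim(A)$ is the number of rows, $\mathrm{index}(A)$ the smallest $i$ with $A_{i,\dim(A)}>0$, $\mathrm{val}(A)=A_{\mathrm{index}(A),\dim(A)}$. $\mathrm{blocks}(A)$ is the number of diagonal blocks of $A$, i.e. the largest $k$ such that $A=\mathrm{diag}(A_1,\dots,A_k)$ is block diagonal with square nonempty blocks $A_i$. For a sequence $y$, $\mathrm{asc}(y)$ is the number of $i$ with $y_i<y_{i+1}$. $\mathrm{Asc}(n)$ is the set of integer sequences $(x_1,\dots,x_n)$ with $x_1=0$ and $x_i\in[0,1+\mathrm{asc}(x_1,\dots,x_{i-1})]$ for $1<i\le n$. Removal operation $f$ on $A\in\mathrm{Int}(n)$, $n\ge2$: (Rem1) if $\mathrm{val}(A)>1$, or if $\mathrm{val}(A)=1$, $\mathrm{index}(A)<\dim(A)$ and row $\mathrm{index}(A)$ has another positive entry, decrease entry $(\mathrm{index}(A),\dim(A))$ by $1$; (Rem2) if $\mathrm{val}(A)=1$ and $\mathrm{index}(A)=\dim(A)$, delete last row and column; (Rem3) if $\mathrm{val}(A)=1$, $\mathrm{index}(A)<\dim(A)$ and all other entries of row $\mathrm{index}(A)$ are $0$, set $A_{i,\dim(A)}:=A_{i,\mathrm{index}(A)}$ for $1\le i\le\mathrm{index}(A)-1$, then delete row and column $\mathrm{index}(A)$. $\Gamma:\mathrm{Int}(n)\to\mathrm{Asc}(n)$: $\Gamma((1))=(0)$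 and for $n\ge2$, $\Gamma(A)$ is $\Gamma(f(A))$ with $\mathrm{index}(A)-1$ appended. Modified ascent sequence $\hat x$: with $\mathfrak{asc}(x)=\{i\in[n-1]:x_i<x_{i+1}\}$, process $i\in\mathfrak{asc}(x)$ in increasing order and for each $j\in[i-1]$ with $x_j\ge x_{i+1}$ (current values) replace $x_j$ by $x_j+1$. Sequence statistics: $\mathrm{zeros}(x)$ is the number of entries equal to $0$; $\mathrm{last}(x)=x_n$; an entry $x_i$ is a right-to-left maximum if no entry to its right is strictly larger, and $\mathrm{rmax}(x)$ is the number of right-to-left maxima. For sequences $x,y$ of non-negative integers, $x\oplus y$ is the concatenation of $x$ with the sequence obtained from $y$ by adding $1+\max(x)$ to each letter; $\mathrm{comp}(x)$ is the largest $k$ such that $x$ is a $\oplus$-sum of $k$ nonempty sequences of non-negative integers. -}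

module Defs where

open import Data.Nat using (ℕ; zero; suc; _+_; _*_; _∸_; _^_; _≤_; _<_; _⊔_; _<ᵇ_; _≤ᵇ_; _≡ᵇ_; pred)
open import Data.Bool using (Bool; true; false; if_then_else_; _∧_; _∨_; not)
open import Data.Fin using (Fin; toℕ; fromℕ)
open import Data.Vec using (Vec; []; _∷_; lookup; removeAt; updateAt; init; tabulate)
import Data.Vec as V
open import Data.List using (List; []; _∷_; _++_; length; map; foldr; foldl; upTo)
open import Data.Nat.ListAction using (sum)
import Data.List as L
open import Data.List.Relation.Unary.All using (All)
open import Data.Product using (Σ; _×_; _,_; proj₁; proj₂; ∃-syntax)
open import Relation.Binary.PropositionalEquality using (_≡_; _≢_)

-- Square matrices of natural numbers: a d×d matrix is a vector of d rows.
-- Indices are 0-based Fin d; the paper's entry A_{i,j} (1-based) is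
-- entry A (i-1) (j-1).

Mat : ℕ → Set
Mat d = Vec (Vec ℕ d) d

entry : ∀ {d} → Mat d → Fin d → Fin d → ℕ
entry A i j = lookup (lookup A i) j

rowSum : ∀ {d} → Mat d → Fin d → ℕ
rowSum A i = V.sum (lookup A i)

totalSum : ∀ {d} → Mat d → ℕ
totalSum A = V.sum (V.map V.sum A)

record IsInt (n : ℕ) {d : ℕ} (A : Mat d) : Set where
  field
    upperTriangular : ∀ (i j : Fin d) → toℕ j < toℕ i → entry A i j ≡ 0
    sumIsN          : totalSum A ≡ n
    rowsNonzero     : ∀ (i : Fin d) → ∃[ j ] (0 < entry A i j)
    colsNonzero     : ∀ (j : Fin d) → ∃[ i ] (0 < entry A i j)

lastEntry : ∀ {m} → Vec ℕ m → ℕ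
lastEntry [] = 0
lastEntry (x ∷ []) = x
lastEntry (x ∷ y ∷ ys) = lastEntry (y ∷ ys)

lastCol : ∀ {d} → Mat d → Vec ℕ d
lastCol A = V.map lastEntry A

-- first position (0-based) of a positive entry; the last position if none
firstPos : ∀ {k} → Vec ℕ (suc k) → Fin (suc k)
firstPos (x ∷ []) = Fin.zero
firstPos (x ∷ y ∷ ys) with 0 <ᵇ x
... | true  = Fin.zero
... | false = Fin.suc (firstPos (y ∷ ys))

indexFin : ∀ {k} → Mat (suc k) → Fin (suc k)
indexFin A = firstPos (lastCol A)

-- index(A): smallest (1-based) i with A_{i,dim A} > 0
index : ∀ {d} → Mat d → ℕ
index {zero} A = 0
index {suc k} A = suc (toℕ (indexFin A))

val : ∀ {k} → Mat (suc k) → ℕ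
val {k} A = entry A (indexFin A) (fromℕ k)

rem1 : ∀ {k} → Mat (suc k) → Mat (suc k)
rem1 {k} A = updateAt A (indexFin A) (λ row → updateAt row (fromℕ k) pred)

rem2 : ∀ {k} → Mat (suc k) → Mat k
rem2 A = V.map init (init A)

rem3 : ∀ {k} → Mat (suc k) → Mat k
rem3 {k} A = V.map (λ row → removeAt row i) (removeAt A' i)
  where
  i = indexFin A
  A' : Mat (suc k)
  A' = tabulate λ r →
         if toℕ r <ᵇ toℕ i
         then updateAt (lookup A r) (fromℕ k) (λ _ → entry A r i)
         else lookup A r

removal : ∀ {k} → Mat (suc k) → Σ ℕ Mat
removal {k} A =
  if (1 <ᵇ val A) ∨ ((val A ≡ᵇ 1) ∧ (toℕ (indexFin A) <ᵇ k) ∧ (val A <ᵇ rowSum A (indexFin A)))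
  then (suc k , rem1 A)
  else (if toℕ (indexFin A) ≡ᵇ k then (k , rem2 A) else (k , rem3 A))

-- Γ : Int(n) → Asc(n), by recursion on n (the "fuel" is the entry sum n)

gammaAux : ℕ → (d : ℕ) → Mat d → List ℕ
gammaAux zero d A = []
gammaAux (suc zero) d A = 0 ∷ []
gammaAux (suc (suc m)) zero A = []
gammaAux (suc (suc m)) (suc k) A =
  gammaAux (suc m) (proj₁ (removal A)) (proj₂ (removal A)) ++ (index A ∸ 1 ∷ [])

Γ : (n : ℕ) → ∀ {d} → Mat d → List ℕ
Γ n {d} A = gammaAux n d A

-- Sequence statistics (sequences are lists; positions 0-based internally)

at : List ℕ → ℕ → ℕ
at [] _ = 0
at (x ∷ xs) zero = x
at (x ∷ xs) (suc i) = at xs i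

asc : List ℕ → ℕ
asc [] = 0
asc (x ∷ []) = 0
asc (x ∷ y ∷ ys) = (if x <ᵇ y then 1 else 0) + asc (y ∷ ys)

zeros : List ℕ → ℕ
zeros xs = L.length (L.filterᵇ (λ v → v ≡ᵇ 0) xs)

open import Data.Maybe using (Maybe; just; nothing)
lastOf : List ℕ → Maybe ℕ
lastOf = L.last

-- Modified ascent sequence x̂.
-- Step for the (0-based) position i: if x_i < x_{i+1} then every x_j with
-- j < i and x_j ≥ x_{i+1} (current values) is increased by 1.
hatStep : List ℕ → ℕ → List ℕ
hatStep x i =
  if at x i <ᵇ at x (suc i)
  then L.zipWith (λ j v → if (j <ᵇ i) ∧ (at x (suc i) ≤ᵇ v) then suc v else v)
                 (upTo (length x)) x
  else x

hat : List ℕ → List ℕ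
hat x = foldl hatStep x (upTo (length x ∸ 1))

isRmax : List ℕ → List Bool
isRmax [] = []
isRmax (x ∷ xs) = allLe xs ∷ isRmax xs
  where
  allLe : List ℕ → Bool
  allLe [] = true
  allLe (v ∷ vs) = (v ≤ᵇ x) ∧ allLe vs

rmax : List ℕ → ℕ
rmax xs = L.length (L.filterᵇ (λ b → b) (isRmax xs))

maxL : List ℕ → ℕ
maxL = foldr _⊔_ 0

_⊕_ : List ℕ → List ℕ → List ℕ
x ⊕ y = x ++ map (λ v → v + suc (maxL x)) y

-- OplusSum k x : x is a ⊕-sum of k nonempty sequences (⊕ is associative,
-- so a left-nested sum suffices)
data OplusSum : ℕ → List ℕ → Set where
  single : ∀ {x} → x ≢ [] → OplusSum 1 x
  extend : ∀ {k x y} → OplusSum k x → y ≢ [] → OplusSum (suc k) (x ⊕ y)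

blockOf : List ℕ → ℕ → ℕ
blockOf [] p = 0
blockOf (s ∷ ss) p = if p <ᵇ s then 0 else suc (blockOf ss (p ∸ s))

BlockDiag : ℕ → ∀ {d} → Mat d → Set
BlockDiag k {d} A =
  Σ (List ℕ) λ sizes →
    (length sizes ≡ k) ×
    (All (λ s → 1 ≤ s) sizes) ×
    (sum sizes ≡ d) ×
    (∀ (i j : Fin d) → blockOf sizes (toℕ i) ≢ blockOf sizes (toℕ j) → entry A i j ≡ 0)

IsLargest : (ℕ → Set) → ℕ → Set
IsLargest P m = P m × (∀ k → P k → k ≤ m)

-- Polynomials in q with natural coefficients, as coefficient sequences
-- (coefficient of q^e); equality of polynomials is coefficientwise.

Poly : Set
Poly = ℕ → ℕ

_≈ₚ_ : Poly → Poly → Set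
p ≈ₚ r = ∀ e → p e ≡ r e

monoP : ℕ → ℕ → Poly
monoP c a e = if a ≡ᵇ e then c else 0

zeroP : Poly
zeroP _ = 0

_+ₚ_ : Poly → Poly → Poly
(p +ₚ r) e = p e + r e

sumP : List Poly → Poly
sumP = foldr _+ₚ_ zeroP

qSum : List ℕ → Poly
qSum xs = sumP (map (monoP 1) xs)

qSumRmax : List ℕ → Poly
qSumRmax xs = sumP (L.zipWith (λ b v → if b then monoP 1 v else zeroP) (isRmax xs) xs)

rowPoly : ∀ {d} → Mat d → Poly
rowPoly {d} A = sumP (V.toList (tabulate λ (i : Fin d) → monoP (rowSum A i) (toℕ i)))

lastColPoly : ∀ {d} → Mat d → Poly
lastColPoly {d} A = sumP (V.toList (tabulate λ (i : Fin d) → monoP (lookup (lastCol A) i) (toℕ i)))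

-- sum of the entries of the first row (0 for the empty matrix)
firstRowSum : ∀ {d} → Mat d → ℕ
firstRowSum {zero} A = 0
firstRowSum {suc k} A = rowSum A Fin.zero

lastColSum : ∀ {d} → Mat d → ℕ
lastColSum A = V.sum (lastCol A)

-- Γ(A) is built along the removal sequence A, f(A), f²(A), …, appending index(A) − 1
-- at each step, so everything follows from one invariant (Correspondence), proved by
-- induction on n, between x = Γ(A) and A: x ends in index(A) − 1; zeros(x) is the first
-- row sum; asc(x) = dim A − 1; the value i − 1 occurs r_i(A) times in x̂; it occurs
-- A_{i,dim A} times among the right-to-left maxima of x̂; and for 0 < t < dim A, x̂ is
-- a block of entries < t followed by entries ≥ t exactly when all entries of A in rows
-- < t and columns ≥ t vanish. Appending a to x changes x̂ only by bumping its entries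
-- ≥ a when a is an ascent; this has an effect only in case (Rem3), where the inserted
-- row and column shift the later indices by one. Finally both ⊕-decompositions of x̂
-- and block decompositions of A are chains of such cut points, so comp(x̂) = blocks(A).

module Submission where

open import Defs
open import Data.Nat using (ℕ; zero; suc; _+_; _∸_; _≤_; _<_; _<ᵇ_; _≤ᵇ_; _≡ᵇ_; pred; z≤n; s≤s; z<s; s<s; >-nonZero)
open import Data.Nat.Properties
open import Data.Bool using (Bool; true; false; if_then_else_; _∧_; _∨_; T)
open import Data.Bool.Properties using (∧-zeroʳ; ∧-identityʳ)
open import Data.Bool.ListAction using (all)
open import Data.Unit using (tt; ⊤)
open import Data.Empty using (⊥; ⊥-elim)
open import Data.Sum using (_⊎_; inj₁; inj₂)
open import Data.Product using (Σ; _×_; _,_; proj₁; proj₂; ∃-syntax)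
open import Data.Maybe using (just)
open import Data.List using (List; []; _∷_; _++_; _∷ʳ_; length; map; foldl; upTo; applyUpTo)
import Data.List as L
import Data.List.Properties as LP
open import Data.List.Relation.Unary.All as All using (All; []; _∷_)
import Data.List.Relation.Unary.All.Properties as AllP
open import Data.List.Membership.Propositional using (_∈_)
open import Data.List.Membership.Propositional.Properties using (∈-++⁺ʳ; ∈-++⁻; ∈-map⁺)
open import Data.List.Relation.Unary.Any using (here; there)
open import Data.Nat.ListAction using (sum)
open import Data.Fin using (Fin; toℕ; fromℕ; fromℕ<; punchIn; punchOut; inject₁; lower₁) renaming (zero to fzero; suc to fsuc)
import Data.Fin.Properties as FP
open import Data.Vec using (Vec; lookup; updateAt; removeAt; init; tabulate) renaming ([] to []v; _∷_ to _∷v_)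
import Data.Vec as V
import Data.Vec.Properties as VP
open import Function using (_∘_; id)
open import Relation.Binary using (tri<; tri≈; tri>)
open import Relation.Binary.PropositionalEquality
open import Relation.Nullary using (¬_; yes; no; Dec)
open import Relation.Nullary.Decidable using (_→-dec_)

T⇒≡true : ∀ {b} → T b → b ≡ true
T⇒≡true {true} _ = refl

¬T⇒≡false : ∀ {b} → ¬ T b → b ≡ false
¬T⇒≡false {true} p = ⊥-elim (p tt)
¬T⇒≡false {false} _ = refl

<ᵇ-true : ∀ {m n} → m < n → (m <ᵇ n) ≡ true
<ᵇ-true p = T⇒≡true (<⇒<ᵇ p)

<ᵇ-false : ∀ {m n} → ¬ m < n → (m <ᵇ n) ≡ false
<ᵇ-false {m} {n} p = ¬T⇒≡false (p ∘ <ᵇ⇒< m n)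

≤ᵇ-true : ∀ {m n} → m ≤ n → (m ≤ᵇ n) ≡ true
≤ᵇ-true p = T⇒≡true (≤⇒≤ᵇ p)

≤ᵇ-false : ∀ {m n} → ¬ m ≤ n → (m ≤ᵇ n) ≡ false
≤ᵇ-false {m} {n} p = ¬T⇒≡false (p ∘ ≤ᵇ⇒≤ m n)

≡ᵇ-true : ∀ {m n} → m ≡ n → (m ≡ᵇ n) ≡ true
≡ᵇ-true {m} {n} p = T⇒≡true (≡⇒≡ᵇ m n p)

≡ᵇ-false : ∀ {m n} → m ≢ n → (m ≡ᵇ n) ≡ false
≡ᵇ-false {m} {n} p = ¬T⇒≡false (p ∘ ≡ᵇ⇒≡ m n)

module _ {A : Set} (x y : A) where
  if-< : ∀ {m n} → m < n → (if m <ᵇ n then x else y) ≡ x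
  if-< p rewrite <ᵇ-true p = refl

  if-≮ : ∀ {m n} → ¬ m < n → (if m <ᵇ n then x else y) ≡ y
  if-≮ p rewrite <ᵇ-false p = refl

  if-≡ : ∀ {m n} → m ≡ n → (if m ≡ᵇ n then x else y) ≡ x
  if-≡ p rewrite ≡ᵇ-true p = refl

  if-≢ : ∀ {m n} → m ≢ n → (if m ≡ᵇ n then x else y) ≡ y
  if-≢ p rewrite ≡ᵇ-false p = refl

≤ᵇ-cong : ∀ {m n m' n'} → (m ≤ n → m' ≤ n') → (m' ≤ n' → m ≤ n) → (m ≤ᵇ n) ≡ (m' ≤ᵇ n')
≤ᵇ-cong {m} {n} f g with m ≤? n
... | yes p = trans (≤ᵇ-true p) (sym (≤ᵇ-true (f p)))
... | no p = trans (≤ᵇ-false p) (sym (≤ᵇ-false (p ∘ g)))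

bump : ℕ → ℕ → ℕ
bump a v = if a ≤ᵇ v then suc v else v

bump-< : ∀ {a v} → v < a → bump a v ≡ v
bump-< {a} {v} p rewrite ≤ᵇ-false {a} {v} (<⇒≱ p) = refl

bump-≥ : ∀ {a v} → a ≤ v → bump a v ≡ suc v
bump-≥ p rewrite ≤ᵇ-true p = refl

bump-≤ᵇ : ∀ a v w → (bump a v ≤ᵇ bump a w) ≡ (v ≤ᵇ w)
bump-≤ᵇ a v w with a ≤? v | a ≤? w
... | yes av | yes aw rewrite bump-≥ av | bump-≥ aw = ≤ᵇ-cong {suc v} {suc w} ≤-pred s≤s
... | no av | no aw rewrite bump-< (≰⇒> av) | bump-< (≰⇒> aw) = refl
... | yes av | no aw rewrite bump-≥ av | bump-< (≰⇒> aw) =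
  trans (≤ᵇ-false (λ q → aw (≤-trans av (≤-trans (n≤1+n v) q)))) (sym (≤ᵇ-false (aw ∘ ≤-trans av)))
... | no av | yes aw rewrite bump-< (≰⇒> av) | bump-≥ aw =
  trans (≤ᵇ-true (≤-trans (<⇒≤ (≰⇒> av)) (≤-trans aw (n≤1+n w))))
        (sym (≤ᵇ-true (<⇒≤ (<-≤-trans (≰⇒> av) aw))))

map-bump-id : ∀ a (ys : List ℕ) → All (_< a) ys → map (bump a) ys ≡ ys
map-bump-id a [] _ = refl
map-bump-id a (v ∷ vs) (p ∷ ps) = cong₂ _∷_ (bump-< p) (map-bump-id a vs ps)

hatUpdate : ℕ → ℕ → ℕ → ℕ → ℕ
hatUpdate i c j v = if (j <ᵇ i) ∧ (c ≤ᵇ v) then suc v else v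

module _ (F : ℕ → ℕ → ℕ) where
  zipWith-applyUpTo-∷ʳ : ∀ (g : ℕ → ℕ) (xs : List ℕ) a →
    L.zipWith F (applyUpTo g (length (xs ∷ʳ a))) (xs ∷ʳ a)
      ≡ L.zipWith F (applyUpTo g (length xs)) xs ∷ʳ F (g (length xs)) a
  zipWith-applyUpTo-∷ʳ g [] a = refl
  zipWith-applyUpTo-∷ʳ g (v ∷ vs) a = cong (F (g 0) v ∷_) (zipWith-applyUpTo-∷ʳ (g ∘ suc) vs a)

  zipWith-applyUpTo-map : ∀ (g h : ℕ → ℕ) (xs : List ℕ) →
    (∀ i → i < length xs → F (g i) (at xs i) ≡ h (at xs i)) →
    L.zipWith F (applyUpTo g (length xs)) xs ≡ map h xs
  zipWith-applyUpTo-map g h [] p = refl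
  zipWith-applyUpTo-map g h (v ∷ vs) p =
    cong₂ _∷_ (p 0 z<s) (zipWith-applyUpTo-map (g ∘ suc) h vs (λ i → p (suc i) ∘ s<s))

  at-zipWith-applyUpTo : ∀ (g : ℕ → ℕ) (xs : List ℕ) j → j < length xs →
    at (L.zipWith F (applyUpTo g (length xs)) xs) j ≡ F (g j) (at xs j)
  at-zipWith-applyUpTo g (v ∷ vs) zero p = refl
  at-zipWith-applyUpTo g (v ∷ vs) (suc j) (s<s p) = at-zipWith-applyUpTo (g ∘ suc) vs j p

  length-zipWith-applyUpTo : ∀ (g : ℕ → ℕ) (xs : List ℕ) →
    length (L.zipWith F (applyUpTo g (length xs)) xs) ≡ length xs
  length-zipWith-applyUpTo g [] = refl
  length-zipWith-applyUpTo g (v ∷ vs) = cong suc (length-zipWith-applyUpTo (g ∘ suc) vs)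

at-++ˡ : ∀ (xs ys : List ℕ) i → i < length xs → at (xs ++ ys) i ≡ at xs i
at-++ˡ (v ∷ vs) ys zero p = refl
at-++ˡ (v ∷ vs) ys (suc i) (s<s p) = at-++ˡ vs ys i p

length-∷ʳ : ∀ (xs : List ℕ) a → length (xs ∷ʳ a) ≡ suc (length xs)
length-∷ʳ xs a = trans (LP.length-++ xs) (+-comm (length xs) 1)

at-∷ʳ : ∀ (xs : List ℕ) a → at (xs ∷ʳ a) (length xs) ≡ a
at-∷ʳ [] a = refl
at-∷ʳ (v ∷ vs) a = at-∷ʳ vs a

hatStep-∷ʳ : ∀ xs a i → suc i < length xs → hatStep (xs ∷ʳ a) i ≡ hatStep xs i ∷ʳ a
hatStep-∷ʳ xs a i p
  rewrite at-++ˡ xs (a ∷ []) i (<-trans (n<1+n i) p) | at-++ˡ xs (a ∷ []) (suc i) p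
  with at xs i <ᵇ at xs (suc i)
... | false = refl
... | true = trans (zipWith-applyUpTo-∷ʳ F id xs a)
                   (cong (λ b → L.zipWith F (upTo (length xs)) xs ∷ʳ (if b ∧ (c ≤ᵇ a) then suc a else a))
                         (<ᵇ-false (λ q → <-asym q (<-trans (n<1+n i) p))))
  where
  c = at xs (suc i)
  F = hatUpdate i c

length-hatStep : ∀ xs i → length (hatStep xs i) ≡ length xs
length-hatStep xs i with at xs i <ᵇ at xs (suc i)
... | false = refl
... | true = length-zipWith-applyUpTo (hatUpdate i (at xs (suc i))) id xs

at-hatStep : ∀ xs i j → i ≤ j → j < length xs → at (hatStep xs i) j ≡ at xs j
at-hatStep xs i j i≤j j<n with at xs i <ᵇ at xs (suc i)
... | false = refl
... | true = trans (at-zipWith-applyUpTo F id xs j j<n)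
                   (cong (λ b → if b ∧ (c ≤ᵇ at xs j) then suc (at xs j) else at xs j)
                         (<ᵇ-false (λ q → <⇒≱ q i≤j)))
  where
  c = at xs (suc i)
  F = hatUpdate i c

foldl-hatStep-∷ʳ : ∀ xs a (is : List ℕ) → All (λ i → suc i < length xs) is →
  foldl hatStep (xs ∷ʳ a) is ≡ foldl hatStep xs is ∷ʳ a
foldl-hatStep-∷ʳ xs a [] _ = refl
foldl-hatStep-∷ʳ xs a (i ∷ is) (p ∷ ps) =
  trans (cong (λ w → foldl hatStep w is) (hatStep-∷ʳ xs a i p))
        (foldl-hatStep-∷ʳ (hatStep xs i) a is
          (All.map (λ q → subst (suc _ <_) (sym (length-hatStep xs i)) q) ps))

length-foldl-hatStep : ∀ xs (is : List ℕ) → length (foldl hatStep xs is) ≡ length xs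
length-foldl-hatStep xs [] = refl
length-foldl-hatStep xs (i ∷ is) = trans (length-foldl-hatStep (hatStep xs i) is) (length-hatStep xs i)

at-foldl-hatStep : ∀ xs j (is : List ℕ) → All (_≤ j) is → j < length xs →
  at (foldl hatStep xs is) j ≡ at xs j
at-foldl-hatStep xs j [] _ _ = refl
at-foldl-hatStep xs j (i ∷ is) (p ∷ ps) j<n =
  trans (at-foldl-hatStep (hatStep xs i) j is ps (subst (j <_) (sym (length-hatStep xs i)) j<n))
        (at-hatStep xs i j p j<n)

upTo-< : ∀ n → All (_< n) (upTo n)
upTo-< n = AllP.applyUpTo⁺₁ id n id

length-hat : ∀ x → length (hat x) ≡ length x
length-hat x = length-foldl-hatStep x (upTo (length x ∸ 1))

hatStep-last : ∀ w a N l → length w ≡ suc N → at w N ≡ l →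
  hatStep (w ∷ʳ a) N ≡ (if l <ᵇ a then map (bump a) w else w) ∷ʳ a
hatStep-last w a N l len-w at-w = go atN atN+1
  where
  atN : at (w ∷ʳ a) N ≡ l
  atN = trans (at-++ˡ w (a ∷ []) N (subst (N <_) (sym len-w) (n<1+n N))) at-w
  atN+1 : at (w ∷ʳ a) (suc N) ≡ a
  atN+1 = trans (cong (at (w ∷ʳ a)) (sym len-w)) (at-∷ʳ w a)
  F = hatUpdate N a
  bumps : l < a → L.zipWith F (upTo (length w)) w ≡ map (bump a) w
  bumps l<a = zipWith-applyUpTo-map F id (bump a) w λ i i<n →
    atUpdate i (m≤n⇒m<n∨m≡n (≤-pred (subst (i <_) len-w i<n)))
    where
    atUpdate : ∀ i → i < N ⊎ i ≡ N → F i (at w i) ≡ bump a (at w i)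
    atUpdate i (inj₁ p) rewrite <ᵇ-true p = refl
    atUpdate i (inj₂ refl) rewrite <ᵇ-false {i} {i} (<-irrefl refl) | at-w | ≤ᵇ-false {a} {l} (<⇒≱ l<a) = refl
  go : ∀ {u v} → u ≡ l → v ≡ a →
    (if u <ᵇ v then L.zipWith (hatUpdate N v) (upTo (length (w ∷ʳ a))) (w ∷ʳ a) else w ∷ʳ a)
      ≡ (if l <ᵇ a then map (bump a) w else w) ∷ʳ a
  go refl refl with l <ᵇ a in eq
  ... | false = refl
  ... | true = trans (zipWith-applyUpTo-∷ʳ F id w a)
     (cong₂ _∷ʳ_ (bumps (<ᵇ⇒< l a (subst T (sym eq) tt)))
       (cong (λ b → if b ∧ (a ≤ᵇ a) then suc a else a)
         (<ᵇ-false {length w} {N} (λ q → <-irrefl refl (<-trans (subst (_< N) len-w q) (n<1+n N))))))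

hat-∷ʳ : ∀ x l a →
  hat (x ∷ʳ l ∷ʳ a) ≡ (if l <ᵇ a then map (bump a) (hat (x ∷ʳ l)) else hat (x ∷ʳ l)) ∷ʳ a
hat-∷ʳ x l a = begin
    hat (y ∷ʳ a)
      ≡⟨ cong (λ m → foldl hatStep (y ∷ʳ a) (upTo m)) len-ya ⟩
    foldl hatStep (y ∷ʳ a) (upTo (suc N))
      ≡⟨ cong (foldl hatStep (y ∷ʳ a)) (sym (LP.upTo-∷ʳ N)) ⟩
    foldl hatStep (y ∷ʳ a) (upTo N ∷ʳ N)
      ≡⟨ LP.foldl-∷ʳ hatStep (y ∷ʳ a) N (upTo N) ⟩
    hatStep (foldl hatStep (y ∷ʳ a) (upTo N)) N
      ≡⟨ cong (λ v → hatStep v N) (foldl-hatStep-∷ʳ y a (upTo N) inner) ⟩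
    hatStep (foldl hatStep y (upTo N) ∷ʳ a) N
      ≡⟨ cong (λ v → hatStep (v ∷ʳ a) N) (sym hat-y) ⟩
    hatStep (hat y ∷ʳ a) N
      ≡⟨ hatStep-last (hat y) a N l (trans (length-hat y) len-y) at-hat-y ⟩
    (if l <ᵇ a then map (bump a) (hat y) else hat y) ∷ʳ a ∎
  where
  open ≡-Reasoning
  y = x ∷ʳ l
  N = length x
  len-y : length y ≡ suc N
  len-y = length-∷ʳ x l
  len-ya : length (y ∷ʳ a) ∸ 1 ≡ suc N
  len-ya = trans (cong (_∸ 1) (length-∷ʳ y a)) len-y
  hat-y : hat y ≡ foldl hatStep y (upTo N)
  hat-y = cong (λ m → foldl hatStep y (upTo (m ∸ 1))) len-y
  at-hat-y : at (hat y) N ≡ l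
  at-hat-y = trans (cong (λ v → at v N) hat-y)
    (trans (at-foldl-hatStep y N (upTo N) (All.map <⇒≤ (upTo-< N)) (subst (N <_) (sym len-y) (n<1+n N)))
           (at-∷ʳ x l))
  inner : All (λ i → suc i < length y) (upTo N)
  inner = All.map (λ q → subst (suc _ <_) (sym len-y) (s<s q)) (upTo-< N)

last-∷ʳ : ∀ (xs : List ℕ) a → lastOf (xs ∷ʳ a) ≡ just a
last-∷ʳ [] a = refl
last-∷ʳ (v ∷ []) a = refl
last-∷ʳ (v ∷ w ∷ vs) a = last-∷ʳ (w ∷ vs) a

isZero : ℕ → ℕ
isZero v = if v ≡ᵇ 0 then 1 else 0

zeros-∷ : ∀ v vs → zeros (v ∷ vs) ≡ isZero v + zeros vs
zeros-∷ zero vs = refl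
zeros-∷ (suc v) vs = refl

zeros-∷ʳ : ∀ (xs : List ℕ) a → zeros (xs ∷ʳ a) ≡ zeros xs + isZero a
zeros-∷ʳ [] zero = refl
zeros-∷ʳ [] (suc a) = refl
zeros-∷ʳ (v ∷ vs) a = begin
  zeros (v ∷ vs ∷ʳ a)            ≡⟨ zeros-∷ v (vs ∷ʳ a) ⟩
  isZero v + zeros (vs ∷ʳ a)     ≡⟨ cong (isZero v +_) (zeros-∷ʳ vs a) ⟩
  isZero v + (zeros vs + isZero a) ≡⟨ +-assoc (isZero v) (zeros vs) (isZero a) ⟨
  isZero v + zeros vs + isZero a ≡⟨ cong (_+ isZero a) (zeros-∷ v vs) ⟨
  zeros (v ∷ vs) + isZero a ∎
  where open ≡-Reasoning

isAscent : ℕ → ℕ → ℕ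
isAscent l a = if l <ᵇ a then 1 else 0

asc-∷ʳ : ∀ (x : List ℕ) l a → asc (x ∷ʳ l ∷ʳ a) ≡ asc (x ∷ʳ l) + isAscent l a
asc-∷ʳ [] l a = +-identityʳ _
asc-∷ʳ (v ∷ []) l a =
  trans (cong (isAscent v l +_) (asc-∷ʳ [] l a)) (sym (+-assoc (isAscent v l) 0 _))
asc-∷ʳ (v ∷ w ∷ vs) l a =
  trans (cong (isAscent v w +_) (asc-∷ʳ (w ∷ vs) l a))
        (sym (+-assoc (isAscent v w) (asc (w ∷ vs ∷ʳ l)) _))

-- qSum xs e counts the entries of xs equal to e.

δ : ℕ → ℕ → ℕ
δ v e = if v ≡ᵇ e then 1 else 0

δ-refl : ∀ v → δ v v ≡ 1
δ-refl v = if-≡ 1 0 {v} refl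

δ-≢ : ∀ {v e} → v ≢ e → δ v e ≡ 0
δ-≢ = if-≢ 1 0

qSum-++ : ∀ (xs ys : List ℕ) e → qSum (xs ++ ys) e ≡ qSum xs e + qSum ys e
qSum-++ [] ys e = refl
qSum-++ (v ∷ vs) ys e =
  trans (cong (δ v e +_) (qSum-++ vs ys e)) (sym (+-assoc (δ v e) (qSum vs e) _))

qSum-∷ʳ : ∀ (xs : List ℕ) a e → qSum (xs ∷ʳ a) e ≡ qSum xs e + δ a e
qSum-∷ʳ xs a e = trans (qSum-++ xs (a ∷ []) e) (cong (qSum xs e +_) (+-identityʳ _))

qSum-pos⇒∈ : ∀ (ys : List ℕ) e → 0 < qSum ys e → e ∈ ys
qSum-pos⇒∈ (v ∷ vs) e p with v ≟ e
... | yes refl = here refl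
... | no v≢e = there (qSum-pos⇒∈ vs e (subst (0 <_) (cong (_+ qSum vs e) (δ-≢ v≢e)) p))

qSum-zero⇒All< : ∀ (ys : List ℕ) b → (∀ e → b ≤ e → qSum ys e ≡ 0) → All (_< b) ys
qSum-zero⇒All< [] b h = []
qSum-zero⇒All< (v ∷ vs) b h = v<b ∷ qSum-zero⇒All< vs b (λ e b≤e → m+n≡0⇒n≡0 (δ v e) (h e b≤e))
  where
  v<b : v < b
  v<b with b ≤? v
  ... | no b≰v = ≰⇒> b≰v
  ... | yes b≤v = ⊥-elim (1+n≢0 (trans (cong (_+ qSum vs v) (sym (δ-refl v))) (h v b≤v)))

All<⇒qSum-zero : ∀ {b} (ys : List ℕ) e → All (_< b) ys → b ≤ e → qSum ys e ≡ 0
All<⇒qSum-zero [] e _ _ = refl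
All<⇒qSum-zero (v ∷ vs) e (p ∷ ps) b≤e =
  cong₂ _+_ (δ-≢ (λ q → <-irrefl q (<-≤-trans p b≤e))) (All<⇒qSum-zero vs e ps b≤e)

-- The counting polynomial of map (bump a) ys: coefficients from a on move up one place.
bumpPoly : ℕ → Poly → Poly
bumpPoly a p e = if e <ᵇ a then p e else (if e ≡ᵇ a then 0 else p (pred e))

bumpPoly-+ : ∀ a (p r : Poly) e → bumpPoly a (p +ₚ r) e ≡ bumpPoly a p e + bumpPoly a r e
bumpPoly-+ a p r e with e <ᵇ a | e ≡ᵇ a
... | true | _ = refl
... | false | true = refl
... | false | false = refl

δ-bump : ∀ a v e → δ (bump a v) e ≡ bumpPoly a (δ v) e
δ-bump a v e with <-cmp e a | v <? a
... | tri< e<a _ _ | yes v<a = trans (cong (λ u → δ u e) (bump-< v<a)) (sym (if-< _ _ e<a))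
... | tri< e<a _ _ | no v≮a = trans (cong (λ u → δ u e) (bump-≥ a≤v))
      (trans (δ-≢ (λ q → <⇒≱ e<a (≤-trans a≤v (≤-trans (n≤1+n v) (≤-reflexive q)))))
             (sym (trans (if-< _ _ e<a) (δ-≢ (λ q → <⇒≱ e<a (≤-trans a≤v (≤-reflexive q)))))))
  where a≤v = ≮⇒≥ v≮a
... | tri≈ _ refl _ | yes v<a = trans (cong (λ u → δ u e) (bump-< v<a))
      (trans (δ-≢ (λ q → <-irrefl q v<a)) (sym (trans (if-≮ _ _ {e} {e} (<-irrefl refl)) (if-≡ _ _ {e} refl))))
... | tri≈ _ refl _ | no v≮a = trans (cong (λ u → δ u e) (bump-≥ (≮⇒≥ v≮a)))
      (trans (δ-≢ (λ q → 1+n≰n (subst (_≤ v) (sym q) (≮⇒≥ v≮a))))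
             (sym (trans (if-≮ _ _ {e} {e} (<-irrefl refl)) (if-≡ _ _ {e} refl))))
δ-bump a v (suc e) | tri> _ _ a<e | yes v<a = trans (cong (λ u → δ u (suc e)) (bump-< v<a))
      (trans (δ-≢ (λ q → <-irrefl q (<-trans v<a a<e)))
        (sym (trans (if-≮ _ _ (<⇒≯ a<e)) (trans (if-≢ _ _ (λ q → <-irrefl (sym q) a<e))
          (δ-≢ (λ q → <-irrefl q (<-≤-trans v<a (≤-pred a<e))))))))
δ-bump a v (suc e) | tri> _ _ a<e | no v≮a = trans (cong (λ u → δ u (suc e)) (bump-≥ (≮⇒≥ v≮a)))
      (sym (trans (if-≮ _ _ (<⇒≯ a<e)) (if-≢ _ _ (λ q → <-irrefl (sym q) a<e))))

qSum-map-bump : ∀ a (ys : List ℕ) e → qSum (map (bump a) ys) e ≡ bumpPoly a (qSum ys) e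
qSum-map-bump a [] e with e <ᵇ a | e ≡ᵇ a
... | true | _ = refl
... | false | true = refl
... | false | false = refl
qSum-map-bump a (v ∷ vs) e =
  trans (cong₂ _+_ (δ-bump a v e) (qSum-map-bump a vs e)) (sym (bumpPoly-+ a (δ v) (qSum vs) e))

rmaxFlag-∷ : ∀ x xs → isRmax (x ∷ xs) ≡ all (_≤ᵇ x) xs ∷ isRmax xs
rmaxFlag-∷ x [] = refl
rmaxFlag-∷ x (v ∷ vs) = cong (λ b → ((v ≤ᵇ x) ∧ b) ∷ isRmax (v ∷ vs)) (cong head (rmaxFlag-∷ x vs))
  where
  head : List Bool → Bool
  head [] = false
  head (b ∷ _) = b

rmaxValues : List ℕ → List ℕ
rmaxValues [] = []
rmaxValues (v ∷ vs) = if all (_≤ᵇ v) vs then v ∷ rmaxValues vs else rmaxValues vs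

rmax≡length-rmaxValues : ∀ xs → rmax xs ≡ length (rmaxValues xs)
rmax≡length-rmaxValues [] = refl
rmax≡length-rmaxValues (x ∷ xs) = trans (cong countTrue (rmaxFlag-∷ x xs)) (go (all (_≤ᵇ x) xs))
  where
  countTrue : List Bool → ℕ
  countTrue bs = length (L.filterᵇ (λ b → b) bs)
  go : ∀ b → countTrue (b ∷ isRmax xs) ≡ length (if b then x ∷ rmaxValues xs else rmaxValues xs)
  go true = cong suc (rmax≡length-rmaxValues xs)
  go false = rmax≡length-rmaxValues xs

qSumRmax≡qSum-rmaxValues : ∀ xs e → qSumRmax xs e ≡ qSum (rmaxValues xs) e
qSumRmax≡qSum-rmaxValues [] e = refl
qSumRmax≡qSum-rmaxValues (x ∷ xs) e =
  trans (cong (λ bs → sumP (L.zipWith select bs (x ∷ xs)) e) (rmaxFlag-∷ x xs)) (go (all (_≤ᵇ x) xs))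
  where
  select : Bool → ℕ → Poly
  select b v = if b then monoP 1 v else zeroP
  go : ∀ b → sumP (L.zipWith select (b ∷ isRmax xs) (x ∷ xs)) e
           ≡ qSum (if b then x ∷ rmaxValues xs else rmaxValues xs) e
  go true = cong (δ x e +_) (qSumRmax≡qSum-rmaxValues xs e)
  go false = qSumRmax≡qSum-rmaxValues xs e

atLeast : ℕ → List ℕ → List ℕ
atLeast a [] = []
atLeast a (v ∷ vs) = if a ≤ᵇ v then v ∷ atLeast a vs else atLeast a vs

all-≤ᵇ-∷ʳ : ∀ x (vs : List ℕ) a → all (_≤ᵇ x) (vs ∷ʳ a) ≡ (a ≤ᵇ x) ∧ all (_≤ᵇ x) vs
all-≤ᵇ-∷ʳ x [] a with a ≤ᵇ x
... | true = refl
... | false = refl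
all-≤ᵇ-∷ʳ x (v ∷ vs) a rewrite all-≤ᵇ-∷ʳ x vs a with v ≤ᵇ x | a ≤ᵇ x
... | true | true = refl
... | true | false = refl
... | false | true = refl
... | false | false = refl

rmaxValues-∷ʳ : ∀ (ws : List ℕ) a → rmaxValues (ws ∷ʳ a) ≡ atLeast a (rmaxValues ws) ∷ʳ a
rmaxValues-∷ʳ [] a = refl
rmaxValues-∷ʳ (v ∷ vs) a rewrite all-≤ᵇ-∷ʳ v vs a with all (_≤ᵇ v) vs
... | false rewrite ∧-zeroʳ (a ≤ᵇ v) = rmaxValues-∷ʳ vs a
... | true rewrite ∧-identityʳ (a ≤ᵇ v) with a ≤ᵇ v
... | true = cong (v ∷_) (rmaxValues-∷ʳ vs a)
... | false = rmaxValues-∷ʳ vs a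

all-≤ᵇ-bump : ∀ a x vs → all (_≤ᵇ bump a x) (map (bump a) vs) ≡ all (_≤ᵇ x) vs
all-≤ᵇ-bump a x [] = refl
all-≤ᵇ-bump a x (v ∷ vs) = cong₂ _∧_ (bump-≤ᵇ a v x) (all-≤ᵇ-bump a x vs)

rmaxValues-map-bump : ∀ a ws → rmaxValues (map (bump a) ws) ≡ map (bump a) (rmaxValues ws)
rmaxValues-map-bump a [] = refl
rmaxValues-map-bump a (v ∷ vs) rewrite all-≤ᵇ-bump a v vs with all (_≤ᵇ v) vs
... | true = cong (bump a v ∷_) (rmaxValues-map-bump a vs)
... | false = rmaxValues-map-bump a vs

rmaxValues-All : ∀ {P : ℕ → Set} (ys : List ℕ) → All P ys → All P (rmaxValues ys)
rmaxValues-All [] _ = []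
rmaxValues-All (v ∷ vs) (p ∷ ps) with all (_≤ᵇ v) vs
... | true = p ∷ rmaxValues-All vs ps
... | false = rmaxValues-All vs ps

qSum-atLeast : ∀ a ws e → qSum (atLeast a ws) e ≡ (if e <ᵇ a then 0 else qSum ws e)
qSum-atLeast a [] e with e <ᵇ a
... | true = refl
... | false = refl
qSum-atLeast a (v ∷ vs) e with a ≤? v | e <? a
... | yes a≤v | yes e<a rewrite ≤ᵇ-true a≤v | <ᵇ-true e<a =
  trans (cong (_+ qSum (atLeast a vs) e) (δ-≢ (λ q → <⇒≱ e<a (≤-trans a≤v (≤-reflexive q)))))
        (trans (qSum-atLeast a vs e) (if-< _ _ e<a))
... | yes a≤v | no e≮a rewrite ≤ᵇ-true a≤v | <ᵇ-false e≮a =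
  cong (δ v e +_) (trans (qSum-atLeast a vs e) (if-≮ _ _ e≮a))
... | no a≰v | yes e<a rewrite ≤ᵇ-false a≰v | <ᵇ-true e<a = trans (qSum-atLeast a vs e) (if-< _ _ e<a)
... | no a≰v | no e≮a rewrite ≤ᵇ-false a≰v | <ᵇ-false e≮a =
  trans (qSum-atLeast a vs e) (trans (if-≮ _ _ e≮a)
    (cong (_+ qSum vs e) (sym (δ-≢ (λ q → a≰v (≤-trans (≮⇒≥ e≮a) (≤-reflexive (sym q))))))))

-- Equivalently (CutAt⇒split): entries < t followed by entries ≥ t.
CutAt : ℕ → List ℕ → Set
CutAt t [] = ⊤
CutAt t (v ∷ vs) = (t ≤ v → All (t ≤_) vs) × CutAt t vs

CutAt-++⁻ˡ : ∀ t (xs ys : List ℕ) → CutAt t (xs ++ ys) → CutAt t xs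
CutAt-++⁻ˡ t [] ys c = tt
CutAt-++⁻ˡ t (v ∷ vs) ys (f , c) = (AllP.++⁻ˡ vs ∘ f) , CutAt-++⁻ˡ t vs ys c

CutAt-∷ʳ⁻ : ∀ t (ys : List ℕ) a → CutAt t (ys ∷ʳ a) → a < t → All (_< t) ys
CutAt-∷ʳ⁻ t [] a c a<t = []
CutAt-∷ʳ⁻ t (v ∷ vs) a (f , c) a<t with t ≤? v
... | yes t≤v = ⊥-elim (<⇒≱ a<t (All.head (AllP.++⁻ʳ vs (f t≤v))))
... | no t≰v = ≰⇒> t≰v ∷ CutAt-∷ʳ⁻ t vs a c a<t

All≥⇒CutAt : ∀ t (z : List ℕ) → All (t ≤_) z → CutAt t z
All≥⇒CutAt t [] _ = tt
All≥⇒CutAt t (v ∷ vs) (p ∷ ps) = (λ _ → ps) , All≥⇒CutAt t vs ps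

All<⇒CutAt : ∀ t (ys : List ℕ) → All (_< t) ys → CutAt t ys
All<⇒CutAt t [] _ = tt
All<⇒CutAt t (v ∷ vs) (p ∷ ps) = (⊥-elim ∘ <⇒≱ p) , All<⇒CutAt t vs ps

CutAt-++ : ∀ t (x z : List ℕ) → CutAt t x → All (t ≤_) z → CutAt t (x ++ z)
CutAt-++ t [] z _ pz = All≥⇒CutAt t z pz
CutAt-++ t (v ∷ vs) z (f , c) pz = (λ q → AllP.++⁺ (f q) pz) , CutAt-++ t vs z c pz

CutAt-∷ʳ : ∀ t (ys : List ℕ) a → CutAt t ys → t ≤ a → CutAt t (ys ∷ʳ a)
CutAt-∷ʳ t ys a c t≤a = CutAt-++ t ys (a ∷ []) c (t≤a ∷ [])

CutAt⇒split : ∀ t (y : List ℕ) → CutAt t y →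
  Σ (List ℕ) λ p → Σ (List ℕ) λ r → (y ≡ p ++ r) × All (_< t) p × All (t ≤_) r
CutAt⇒split t [] c = [] , [] , refl , [] , []
CutAt⇒split t (v ∷ vs) (f , c) with t ≤? v
... | yes t≤v = [] , v ∷ vs , refl , [] , t≤v ∷ f t≤v
... | no t≰v with CutAt⇒split t vs c
... | p , r , eq , ap , ar = v ∷ p , r , cong (v ∷_) eq , ≰⇒> t≰v ∷ ap , ar

≤-bump⇔ : ∀ {t a} v → t ≤ a → (t ≤ bump a v → t ≤ v) × (t ≤ v → t ≤ bump a v)
≤-bump⇔ {t} {a} v t≤a with a ≤? v
... | yes a≤v rewrite bump-≥ a≤v = (λ _ → ≤-trans t≤a a≤v) , (λ p → ≤-trans p (n≤1+n v))
... | no a≰v rewrite bump-< (≰⇒> a≰v) = id , id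

CutAt-map-bump⁻ : ∀ t a (ys : List ℕ) → t ≤ a → CutAt t (map (bump a) ys) → CutAt t ys
CutAt-map-bump⁻ t a [] t≤a c = tt
CutAt-map-bump⁻ t a (v ∷ vs) t≤a (f , c) =
  (λ p → All.map (λ {i} q → proj₁ (≤-bump⇔ i t≤a) q) (AllP.map⁻ (f (proj₂ (≤-bump⇔ v t≤a) p)))) ,
  CutAt-map-bump⁻ t a vs t≤a c

CutAt-map-bump⁺ : ∀ t a (ys : List ℕ) → t ≤ a → CutAt t ys → CutAt t (map (bump a) ys)
CutAt-map-bump⁺ t a [] t≤a c = tt
CutAt-map-bump⁺ t a (v ∷ vs) t≤a (f , c) =
  (λ p → AllP.map⁺ (All.map (λ {i} q → proj₂ (≤-bump⇔ i t≤a) q) (f (proj₁ (≤-bump⇔ v t≤a) p)))) ,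
  CutAt-map-bump⁺ t a vs t≤a c

∈⇒¬All< : ∀ {t e} (ys : List ℕ) → e ∈ ys → t ≤ e → ¬ All (_< t) ys
∈⇒¬All< ys e∈ys t≤e all< = <⇒≱ (All.lookup all< e∈ys) t≤e

Chain : ℕ → List ℕ → Set
Chain b [] = ⊤
Chain b (t ∷ L) = t < b × 0 < t × Chain t L

Chain-weaken : ∀ {b b'} L → b ≤ b' → Chain b L → Chain b' L
Chain-weaken [] _ _ = tt
Chain-weaken (t ∷ L) b≤b' (t<b , 0<t , c) = <-≤-trans t<b b≤b' , 0<t , c

Chain⇒All< : ∀ {b} L → Chain b L → All (_< b) L
Chain⇒All< [] _ = []
Chain⇒All< (t ∷ L) (t<b , _ , c) = t<b ∷ All.map (λ z → <-trans z t<b) (Chain⇒All< L c)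

Chain⇒All-pos : ∀ {b} L → Chain b L → All (0 <_) L
Chain⇒All-pos [] _ = []
Chain⇒All-pos (t ∷ L) (_ , 0<t , c) = 0<t ∷ Chain⇒All-pos L c

All≤maxL : ∀ (xs : List ℕ) → All (_≤ maxL xs) xs
All≤maxL [] = []
All≤maxL (v ∷ vs) = m≤m⊔n v (maxL vs) ∷ All.map (λ p → ≤-trans p (m≤n⊔m v (maxL vs))) (All≤maxL vs)

∈⇒≤maxL : ∀ {v} (xs : List ℕ) → v ∈ xs → v ≤ maxL xs
∈⇒≤maxL xs = All.lookup (All≤maxL xs)

maxL-lub : ∀ {b} (xs : List ℕ) → All (_≤ b) xs → maxL xs ≤ b
maxL-lub [] _ = z≤n
maxL-lub (v ∷ vs) (p ∷ ps) = ⊔-lub p (maxL-lub vs ps)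

maxL-⊕ : ∀ (x z : List ℕ) → z ≢ [] → suc (maxL x) ≤ maxL (x ⊕ z)
maxL-⊕ x [] z≢[] = ⊥-elim (z≢[] refl)
maxL-⊕ x (u ∷ us) _ = ≤-trans (m≤n+m (suc (maxL x)) u) (∈⇒≤maxL (x ⊕ (u ∷ us)) (∈-++⁺ʳ x (here refl)))

-- In x ⊕ z the sequence cuts at 1 + max x, and keeps every cut of x.
OplusSum⇒cuts : ∀ {k w} → OplusSum k w →
  Σ (List ℕ) λ L → Chain (suc (maxL w)) L × All (λ t → CutAt t w) L × suc (length L) ≡ k
OplusSum⇒cuts (single _) = [] , tt , [] , refl
OplusSum⇒cuts (extend {k} {x} {z} os z≢[]) with OplusSum⇒cuts os
... | L , chain , cuts , len = t ∷ L , (t<max , z<s , chain) , newCut ∷ oldCuts , cong suc len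
  where
  t = suc (maxL x)
  z' = map (_+ t) z
  z'≥ : ∀ {u} → u ≤ t → All (u ≤_) z'
  z'≥ {u} u≤t = AllP.map⁺ (All.universal (λ i → ≤-trans u≤t (m≤n+m t i)) z)
  newCut : CutAt t (x ++ z')
  newCut = CutAt-++ t x z' (All<⇒CutAt t x (All.map s≤s (All≤maxL x))) (z'≥ ≤-refl)
  oldCuts : All (λ t' → CutAt t' (x ++ z')) L
  oldCuts = All.zipWith (λ (c , t'<t) → CutAt-++ _ x z' c (z'≥ (<⇒≤ t'<t))) (cuts , Chain⇒All< L chain)
  t<max : t < suc (maxL (x ++ z'))
  t<max = s≤s (maxL-⊕ x z z≢[])

-- Cutting at the largest t of the chain splits off the last summand.
cuts⇒OplusSum : ∀ d L y → Chain d L → All (λ t → CutAt t y) L → All (_< d) y →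
  (∀ e → e < d → e ∈ y) → 0 < d → OplusSum (suc (length L)) y
cuts⇒OplusSum d [] y _ _ _ has 0<d = single (λ y≡[] → ∉[] (subst (0 ∈_) y≡[] (has 0 0<d)))
  where
  ∉[] : ¬ (0 ∈ ([] {A = ℕ}))
  ∉[] ()
cuts⇒OplusSum d (t ∷ L) y (t<d , 0<t , chain) (cut ∷ cuts) _ has _ with CutAt⇒split t y cut
... | p , r , y≡p++r , p<t , r≥t =
  subst (OplusSum (suc (suc (length L)))) (sym y≡p⊕z) (extend summands z≢[])
  where
  p-has : ∀ e → e < t → e ∈ p
  p-has e e<t with ∈-++⁻ p (subst (e ∈_) y≡p++r (has e (<-trans e<t t<d)))
  ... | inj₁ e∈p = e∈p
  ... | inj₂ e∈r = ⊥-elim (<⇒≱ e<t (All.lookup r≥t e∈r))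
  suc-pred-t : suc (t ∸ 1) ≡ t
  suc-pred-t = m+[n∸m]≡n 0<t
  max-p : suc (maxL p) ≡ t
  max-p = ≤-antisym
    (subst (suc (maxL p) ≤_) suc-pred-t (s≤s (maxL-lub p (All.map (λ q → ≤-pred (subst (_ <_) (sym suc-pred-t) q)) p<t))))
    (subst (_≤ suc (maxL p)) suc-pred-t (s≤s (∈⇒≤maxL p (p-has (t ∸ 1) (subst (t ∸ 1 <_) suc-pred-t (n<1+n _))))))
  z = map (_∸ t) r
  map-back : map (_+ t) z ≡ r
  map-back = trans (sym (LP.map-∘ r)) (LP.map-id-local (All.map m∸n+n≡m r≥t))
  y≡p⊕z : y ≡ p ⊕ z
  y≡p⊕z = trans y≡p++r (cong (p ++_) (sym (trans (cong (λ s → map (_+ s) z) max-p) map-back)))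
  z≢[] : z ≢ []
  z≢[] z≡[] with ∈-++⁻ p (subst (t ∈_) y≡p++r (has t t<d))
  ... | inj₁ t∈p = <-irrefl refl (All.lookup p<t t∈p)
  ... | inj₂ t∈r = ∉[] (subst (t ∈_) (trans (sym map-back) (cong (map (_+ t)) z≡[])) t∈r)
    where
    ∉[] : ¬ (t ∈ ([] {A = ℕ}))
    ∉[] ()
  summands : OplusSum (suc (length L)) p
  summands = cuts⇒OplusSum t L p chain
    (All.map (λ {t'} c → CutAt-++⁻ˡ t' p r (subst (CutAt t') y≡p++r c)) cuts) p<t p-has 0<t

module LongestChain (Q : ℕ → Set) (Q? : ∀ t → Dec (Q t)) where
  chainBelow : ℕ → List ℕ
  chainBelow zero = []
  chainBelow (suc h) with Q? h | 0 <? h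
  ... | yes _ | yes _ = h ∷ chainBelow h
  ... | _ | _ = chainBelow h

  chainBelow-Chain : ∀ h → Chain h (chainBelow h)
  chainBelow-Chain zero = tt
  chainBelow-Chain (suc h) with Q? h | 0 <? h
  ... | yes _ | yes 0<h = n<1+n h , 0<h , chainBelow-Chain h
  ... | yes _ | no _ = Chain-weaken (chainBelow h) (n≤1+n h) (chainBelow-Chain h)
  ... | no _ | _ = Chain-weaken (chainBelow h) (n≤1+n h) (chainBelow-Chain h)

  chainBelow-All : ∀ h → All Q (chainBelow h)
  chainBelow-All zero = []
  chainBelow-All (suc h) with Q? h | 0 <? h
  ... | yes q | yes _ = q ∷ chainBelow-All h
  ... | yes _ | no _ = chainBelow-All h
  ... | no _ | _ = chainBelow-All h

  length-chainBelow-mono : ∀ h → length (chainBelow h) ≤ length (chainBelow (suc h))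
  length-chainBelow-mono h with Q? h | 0 <? h
  ... | yes _ | yes _ = n≤1+n _
  ... | yes _ | no _ = ≤-refl
  ... | no _ | _ = ≤-refl

  chainBelow-longest : ∀ h L → Chain h L → All Q L → length L ≤ length (chainBelow h)
  chainBelow-longest h [] _ _ = z≤n
  chainBelow-longest zero (t ∷ L) (() , _) _
  chainBelow-longest (suc h) (t ∷ L) (t<1+h , 0<t , c) (qt ∷ qs) with m≤n⇒m<n∨m≡n (≤-pred t<1+h)
  ... | inj₁ t<h = ≤-trans (chainBelow-longest h (t ∷ L) (t<h , 0<t , c) (qt ∷ qs)) (length-chainBelow-mono h)
  ... | inj₂ refl with Q? t | 0 <? t
  ... | yes _ | yes _ = s≤s (chainBelow-longest t L c qs)
  ... | yes _ | no t≯0 = ⊥-elim (t≯0 0<t)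
  ... | no ¬qt | _ = ⊥-elim (¬qt qt)

blockOf-< : ∀ {s p} (r : List ℕ) → p < s → blockOf (s ∷ r) p ≡ 0
blockOf-< r p<s rewrite <ᵇ-true p<s = refl

blockOf-≥ : ∀ {s p} (r : List ℕ) → s ≤ p → blockOf (s ∷ r) p ≡ suc (blockOf r (p ∸ s))
blockOf-≥ {s} {p} r s≤p rewrite <ᵇ-false {p} {s} (≤⇒≯ s≤p) = refl

All-reverse : ∀ {P : ℕ → Set} L → All P L → All P (L.reverse L)
All-reverse [] _ = []
All-reverse (t ∷ L) (p ∷ ps) rewrite LP.unfold-reverse t L = AllP.++⁺ (All-reverse L ps) (p ∷ [])

Ascending : ℕ → List ℕ → Set
Ascending lo [] = ⊤
Ascending lo (t ∷ L) = lo < t × Ascending t L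

Ascending-map-+ : ∀ s lo L → Ascending lo L → Ascending (s + lo) (map (s +_) L)
Ascending-map-+ s lo [] _ = tt
Ascending-map-+ s lo (t ∷ L) (lo<t , asc) = +-monoʳ-< s lo<t , Ascending-map-+ s t L asc

Ascending-∷ʳ : ∀ {lo m} N → Ascending lo N → All (_< m) N → lo < m → Ascending lo (N ∷ʳ m)
Ascending-∷ʳ [] _ _ lo<m = lo<m , tt
Ascending-∷ʳ (n ∷ N) (lo<n , asc) (n<m ∷ ns) _ = lo<n , Ascending-∷ʳ N asc ns n<m

Chain-∷ʳ : ∀ {b t} M → Chain b M → All (t <_) M → t < b → 0 < t → Chain b (M ∷ʳ t)
Chain-∷ʳ [] _ _ t<b 0<t = t<b , 0<t , tt
Chain-∷ʳ (m ∷ M) (m<b , 0<m , c) (t<m ∷ ts) _ 0<t = m<b , 0<m , Chain-∷ʳ M c ts t<m 0<t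

Ascending⇒Chain : ∀ d lo L → Ascending lo L → All (_< d) L →
  Chain d (L.reverse L) × All (lo <_) (L.reverse L)
Ascending⇒Chain d lo [] _ _ = tt , []
Ascending⇒Chain d lo (t ∷ L) (lo<t , asc) (t<d ∷ ts) with Ascending⇒Chain d t L asc ts
... | c , above rewrite LP.unfold-reverse t L =
  Chain-∷ʳ (L.reverse L) c above t<d (≤-<-trans z≤n lo<t) ,
  AllP.++⁺ (All.map (<-trans lo<t) above) (lo<t ∷ [])

Chain⇒Ascending : ∀ b M → Chain b M → Ascending 0 (L.reverse M) × All (_< b) (L.reverse M)
Chain⇒Ascending b [] _ = tt , []
Chain⇒Ascending b (m ∷ M) (m<b , 0<m , c) with Chain⇒Ascending m M c
... | asc , below rewrite LP.unfold-reverse m M =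
  Ascending-∷ʳ (L.reverse M) asc below 0<m , AllP.++⁺ (All.map (λ z → <-trans z m<b) below) (m<b ∷ [])

boundaries : List ℕ → List ℕ
boundaries [] = []
boundaries (s ∷ []) = []
boundaries (s ∷ s' ∷ ss) = s ∷ map (s +_) (boundaries (s' ∷ ss))

length-boundaries : ∀ s ss → suc (length (boundaries (s ∷ ss))) ≡ length (s ∷ ss)
length-boundaries s [] = refl
length-boundaries s (s' ∷ ss) =
  cong suc (trans (cong suc (LP.length-map (s +_) (boundaries (s' ∷ ss)))) (length-boundaries s' ss))

boundaries-Ascending : ∀ sizes → All (1 ≤_) sizes → Ascending 0 (boundaries sizes)
boundaries-Ascending [] _ = tt
boundaries-Ascending (s ∷ []) _ = tt
boundaries-Ascending (s ∷ s' ∷ ss) (1≤s ∷ pos) =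
  1≤s , subst (λ b → Ascending b (map (s +_) (boundaries (s' ∷ ss)))) (+-identityʳ s)
    (Ascending-map-+ s 0 (boundaries (s' ∷ ss)) (boundaries-Ascending (s' ∷ ss) pos))

boundaries-< : ∀ sizes → All (1 ≤_) sizes → All (_< sum sizes) (boundaries sizes)
boundaries-< [] _ = []
boundaries-< (s ∷ []) _ = []
boundaries-< (s ∷ s' ∷ ss) (_ ∷ 1≤s' ∷ pos) =
  subst (_< s + (s' + sum ss)) (+-identityʳ s) (+-monoʳ-< s (<-≤-trans 1≤s' (m≤m+n s' (sum ss))))
  ∷ AllP.map⁺ (All.map (+-monoʳ-< s) (boundaries-< (s' ∷ ss) (1≤s' ∷ pos)))

Separates : List ℕ → ℕ → Set
Separates sizes t = ∀ i j → i < t → t ≤ j → blockOf sizes i ≢ blockOf sizes j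

boundaries-Separates : ∀ sizes → All (Separates sizes) (boundaries sizes)
boundaries-Separates [] = []
boundaries-Separates (s ∷ []) = []
boundaries-Separates (s ∷ s' ∷ ss) =
  first ∷ AllP.map⁺ (All.map (λ {t'} → shifted t') (boundaries-Separates (s' ∷ ss)))
  where
  r = s' ∷ ss
  first : Separates (s ∷ r) s
  first i j i<s s≤j eq = 0≢1+n (trans (sym (blockOf-< r i<s)) (trans eq (blockOf-≥ r s≤j)))
  shifted : ∀ t' → Separates r t' → Separates (s ∷ r) (s + t')
  shifted t' sep i j i<st t≤j eq with s ≤? i
  ... | no s≰i = 0≢1+n (trans (sym (blockOf-< r (≰⇒> s≰i))) (trans eq (blockOf-≥ r (≤-trans (m≤m+n s t') t≤j))))
  ... | yes s≤i = sep (i ∸ s) (j ∸ s)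
      (subst (i ∸ s <_) (m+n∸m≡n s t') (∸-monoˡ-< i<st s≤i))
      (subst (_≤ j ∸ s) (m+n∸m≡n s t') (∸-monoˡ-≤ s t≤j))
      (suc-injective (trans (sym (blockOf-≥ r s≤i)) (trans eq (blockOf-≥ r (≤-trans (m≤m+n s t') t≤j)))))

-- Z i j says that position (i, j) of a d × d array vanishes.
module BlockDecomposition (Z : ℕ → ℕ → Set) (d : ℕ) where
  IsBlockDecomposition : List ℕ → Set
  IsBlockDecomposition sizes = All (1 ≤_) sizes × (sum sizes ≡ d) ×
    (∀ i j → i < d → j < d → blockOf sizes i ≢ blockOf sizes j → Z i j)

  CornerZero : ℕ → Set
  CornerZero t = ∀ i j → i < t → t ≤ j → j < d → Z i j

  blocks⇒splits : ∀ sizes → 0 < d → IsBlockDecomposition sizes →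
    Σ (List ℕ) λ L → Chain d L × All CornerZero L × suc (length L) ≡ length sizes
  blocks⇒splits [] 0<d (_ , sum≡d , _) = ⊥-elim (<-irrefl sum≡d 0<d)
  blocks⇒splits (s ∷ ss) 0<d (pos , sum≡d , sep) =
    L.reverse P , chain , All-reverse P (All.zipWith splits (boundaries-Separates (s ∷ ss) , P<d)) ,
    trans (cong suc (LP.length-reverse P)) (length-boundaries s ss)
    where
    P = boundaries (s ∷ ss)
    P<d : All (_< d) P
    P<d = subst (λ b → All (_< b) P) sum≡d (boundaries-< (s ∷ ss) pos)
    chain : Chain d (L.reverse P)
    chain = proj₁ (Ascending⇒Chain d 0 P (boundaries-Ascending (s ∷ ss) pos) P<d)
    splits : ∀ {t} → Separates (s ∷ ss) t × t < d → CornerZero t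
    splits (sp , t<d) i j i<t t≤j j<d = sep i j (<-trans i<t t<d) j<d (sp i j i<t t≤j)

  module _ (upper : ∀ i j → j < i → Z i j) where
    sizes : ℕ → List ℕ → List ℕ
    sizes lo [] = (d ∸ lo) ∷ []
    sizes lo (t ∷ L) = (t ∸ lo) ∷ sizes t L

    sizes-pos : ∀ lo L → Ascending lo L → All (_< d) L → lo < d → All (1 ≤_) (sizes lo L)
    sizes-pos lo [] _ _ lo<d = m<n⇒0<n∸m lo<d ∷ []
    sizes-pos lo (t ∷ L) (lo<t , asc) (t<d ∷ ts) _ = m<n⇒0<n∸m lo<t ∷ sizes-pos t L asc ts t<d

    sum-sizes : ∀ lo L → Ascending lo L → All (_< d) L → lo ≤ d → sum (sizes lo L) ≡ d ∸ lo
    sum-sizes lo [] _ _ _ = +-identityʳ _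
    sum-sizes lo (t ∷ L) (lo<t , asc) (t<d ∷ ts) _ = begin
      (t ∸ lo) + sum (sizes t L) ≡⟨ cong ((t ∸ lo) +_) (sum-sizes t L asc ts (<⇒≤ t<d)) ⟩
      (t ∸ lo) + (d ∸ t)         ≡⟨ +-comm (t ∸ lo) (d ∸ t) ⟩
      (d ∸ t) + (t ∸ lo)         ≡⟨ +-∸-assoc (d ∸ t) (<⇒≤ lo<t) ⟨
      (d ∸ t + t) ∸ lo           ≡⟨ cong (_∸ lo) (m∸n+n≡m (<⇒≤ t<d)) ⟩
      d ∸ lo ∎
      where open ≡-Reasoning

    length-sizes : ∀ lo L → length (sizes lo L) ≡ suc (length L)
    length-sizes lo [] = refl
    length-sizes lo (t ∷ L) = cong suc (length-sizes t L)

    blockOf-sizes-≥ : ∀ {lo t i} L → lo < t → t ≤ i →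
      blockOf (sizes lo (t ∷ L)) (i ∸ lo) ≡ suc (blockOf (sizes t L) (i ∸ t))
    blockOf-sizes-≥ {lo} {t} {i} L lo<t t≤i =
      trans (blockOf-≥ (sizes t L) (∸-monoˡ-≤ lo t≤i))
            (cong (λ p → suc (blockOf (sizes t L) p))
                  (trans (∸-+-assoc i lo (t ∸ lo)) (cong (i ∸_) (m+[n∸m]≡n (<⇒≤ lo<t)))))

    sizes-separate : ∀ lo L → Ascending lo L → All (_< d) L → All CornerZero L →
      ∀ i j → lo ≤ i → lo ≤ j → i < d → j < d →
      blockOf (sizes lo L) (i ∸ lo) ≢ blockOf (sizes lo L) (j ∸ lo) → Z i j
    sizes-separate lo [] _ _ _ i j lo≤i lo≤j i<d j<d ne =
      ⊥-elim (ne (trans (blockOf-< [] (∸-monoˡ-< i<d lo≤i)) (sym (blockOf-< [] (∸-monoˡ-< j<d lo≤j)))))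
    sizes-separate lo (t ∷ L) (lo<t , asc) (t<d ∷ ts) (split ∷ splits) i j lo≤i lo≤j i<d j<d ne
      with i <? t | j <? t
    ... | yes i<t | yes j<t = ⊥-elim (ne (trans (blockOf-< (sizes t L) (∸-monoˡ-< i<t lo≤i))
                                           (sym (blockOf-< (sizes t L) (∸-monoˡ-< j<t lo≤j)))))
    ... | yes i<t | no j≮t = split i j i<t (≮⇒≥ j≮t) j<d
    ... | no i≮t | yes j<t = upper i j (<-≤-trans j<t (≮⇒≥ i≮t))
    ... | no i≮t | no j≮t = sizes-separate t L asc ts splits i j (≮⇒≥ i≮t) (≮⇒≥ j≮t) i<d j<d λ eq →
      ne (trans (blockOf-sizes-≥ L lo<t (≮⇒≥ i≮t))
           (trans (cong suc eq) (sym (blockOf-sizes-≥ L lo<t (≮⇒≥ j≮t)))))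

    splits⇒blocks : ∀ L → 0 < d → Chain d L → All CornerZero L →
      Σ (List ℕ) λ sz → IsBlockDecomposition sz × length sz ≡ suc (length L)
    splits⇒blocks L 0<d c splits with Chain⇒Ascending d L c
    ... | asc , below =
      sizes 0 R ,
      (sizes-pos 0 R asc below 0<d , sum-sizes 0 R asc below z≤n ,
       λ i j i<d j<d → sizes-separate 0 R asc below (All-reverse L splits) i j z≤n z≤n i<d j<d) ,
      trans (length-sizes 0 R) (cong suc (LP.length-reverse L))
      where
      R = L.reverse L

∑ : ∀ {d} → (Fin d → ℕ) → ℕ
∑ {zero} f = 0
∑ {suc d} f = f fzero + ∑ (f ∘ fsuc)

∑-cong : ∀ {d} {f g : Fin d → ℕ} → (∀ i → f i ≡ g i) → ∑ f ≡ ∑ g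
∑-cong {zero} h = refl
∑-cong {suc d} h = cong₂ _+_ (h fzero) (∑-cong (h ∘ fsuc))

sum≡∑ : ∀ {d} (v : Vec ℕ d) → V.sum v ≡ ∑ (lookup v)
sum≡∑ []v = refl
sum≡∑ (x ∷v v) = cong (x +_) (sum≡∑ v)

∑-punchIn : ∀ {d} (f : Fin (suc d) → ℕ) a → ∑ f ≡ f a + ∑ (f ∘ punchIn a)
∑-punchIn f fzero = refl
∑-punchIn {suc d} f (fsuc a) = begin
  f fzero + ∑ (f ∘ fsuc)                   ≡⟨ cong (f fzero +_) (∑-punchIn (f ∘ fsuc) a) ⟩
  f fzero + (f (fsuc a) + rest)            ≡⟨ +-assoc (f fzero) (f (fsuc a)) rest ⟨
  f fzero + f (fsuc a) + rest              ≡⟨ cong (_+ rest) (+-comm (f fzero) (f (fsuc a))) ⟩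
  f (fsuc a) + f fzero + rest              ≡⟨ +-assoc (f (fsuc a)) (f fzero) rest ⟩
  f (fsuc a) + (f fzero + rest) ∎
  where
  open ≡-Reasoning
  rest = ∑ (f ∘ fsuc ∘ punchIn a)

∑-fromℕ : ∀ {d} (f : Fin (suc d) → ℕ) → ∑ f ≡ ∑ (f ∘ inject₁) + f (fromℕ d)
∑-fromℕ {zero} f = +-comm (f fzero) 0
∑-fromℕ {suc d} f = trans (cong (f fzero +_) (∑-fromℕ (f ∘ fsuc))) (sym (+-assoc (f fzero) _ _))

f≤∑ : ∀ {d} (f : Fin d → ℕ) i → f i ≤ ∑ f
f≤∑ f fzero = m≤m+n _ _
f≤∑ f (fsuc i) = ≤-trans (f≤∑ (f ∘ fsuc) i) (m≤n+m _ (f fzero))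

∑-pos⇒∃ : ∀ {d} (f : Fin d → ℕ) → 0 < ∑ f → ∃[ i ] (0 < f i)
∑-pos⇒∃ {suc d} f p with f fzero in eq
... | suc _ = fzero , subst (0 <_) (sym eq) z<s
... | zero with ∑-pos⇒∃ (f ∘ fsuc) p
... | i , q = fsuc i , q

∀-pos⇒d≤∑ : ∀ {d} (f : Fin d → ℕ) → (∀ i → 0 < f i) → d ≤ ∑ f
∀-pos⇒d≤∑ {zero} f h = z≤n
∀-pos⇒d≤∑ {suc d} f h = +-mono-≤ (h fzero) (∀-pos⇒d≤∑ (f ∘ fsuc) (h ∘ fsuc))

∑-zero : ∀ {d} (f : Fin d → ℕ) → (∀ i → f i ≡ 0) → ∑ f ≡ 0
∑-zero {zero} f h = refl
∑-zero {suc d} f h = cong₂ _+_ (h fzero) (∑-zero (f ∘ fsuc) (h ∘ fsuc))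

∑≡0⇒zero : ∀ {d} (f : Fin d → ℕ) → ∑ f ≡ 0 → ∀ i → f i ≡ 0
∑≡0⇒zero f h i = n≤0⇒n≡0 (≤-trans (f≤∑ f i) (≤-reflexive h))

∑-+ : ∀ {d} (f g : Fin d → ℕ) → ∑ (λ i → f i + g i) ≡ ∑ f + ∑ g
∑-+ {zero} f g = refl
∑-+ {suc d} f g = trans (cong (f fzero + g fzero +_) (∑-+ (f ∘ fsuc) (g ∘ fsuc)))
  (+-*-Solver.solve 4 (λ a b c e → (a :+ b) :+ (c :+ e) := (a :+ c) :+ (b :+ e)) refl
    (f fzero) (g fzero) (∑ (f ∘ fsuc)) (∑ (g ∘ fsuc)))
  where open import Data.Nat.Solver using (module +-*-Solver)
        open +-*-Solver

∑-update : ∀ {d} (f g : Fin (suc d) → ℕ) q → (∀ i → i ≢ q → f i ≡ g i) → ∑ f + g q ≡ ∑ g + f q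
∑-update f g q agree = begin
  ∑ f + g q                  ≡⟨ cong (_+ g q) (∑-punchIn f q) ⟩
  f q + ∑ (f ∘ punchIn q) + g q ≡⟨ cong (λ z → f q + z + g q) (∑-cong (λ i → agree (punchIn q i) (FP.punchInᵢ≢i q i))) ⟩
  f q + rest + g q           ≡⟨ +-comm (f q + rest) (g q) ⟩
  g q + (f q + rest)         ≡⟨ cong (g q +_) (+-comm (f q) rest) ⟩
  g q + (rest + f q)         ≡⟨ +-assoc (g q) rest (f q) ⟨
  g q + rest + f q           ≡⟨ cong (_+ f q) (∑-punchIn g q) ⟨
  ∑ g + f q ∎
  where
  open ≡-Reasoning
  rest = ∑ (g ∘ punchIn q)

∑-suc-at : ∀ {d} (f g : Fin (suc d) → ℕ) q → (∀ i → i ≢ q → f i ≡ g i) → suc (f q) ≡ g q →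
  suc (∑ f) ≡ ∑ g
∑-suc-at f g q agree sq = +-cancelʳ-≡ (f q) _ _ (begin
  suc (∑ f) + f q   ≡⟨ +-suc (∑ f) (f q) ⟨
  ∑ f + suc (f q)   ≡⟨ cong (∑ f +_) sq ⟩
  ∑ f + g q         ≡⟨ ∑-update f g q agree ⟩
  ∑ g + f q ∎)
  where open ≡-Reasoning

∑-δ : ∀ d v → v < d → ∑ {d} (λ i → δ v (toℕ i)) ≡ 1
∑-δ (suc d) zero _ = cong suc (∑-zero {d} (λ i → δ 0 (suc (toℕ i))) (λ i → refl))
∑-δ (suc d) (suc v) (s<s v<d) = ∑-δ d v v<d

length≡∑qSum : ∀ d (xs : List ℕ) → All (_< d) xs → length xs ≡ ∑ {d} (λ i → qSum xs (toℕ i))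
length≡∑qSum d [] _ = sym (∑-zero {d} _ (λ i → refl))
length≡∑qSum d (v ∷ vs) (v<d ∷ vs<d) = sym (begin
  ∑ {d} (λ i → δ v (toℕ i) + qSum vs (toℕ i))     ≡⟨ ∑-+ {d} (λ i → δ v (toℕ i)) (λ i → qSum vs (toℕ i)) ⟩
  ∑ {d} (λ i → δ v (toℕ i)) + ∑ {d} (λ i → qSum vs (toℕ i)) ≡⟨ cong₂ _+_ (∑-δ d v v<d) (sym (length≡∑qSum d vs vs<d)) ⟩
  suc (length vs) ∎)
  where open ≡-Reasoning

-- coeff f e is the coefficient of q^e in ∑ᵢ f i q^i.
coeff : ∀ {d} → (Fin d → ℕ) → ℕ → ℕ
coeff {zero} f e = 0
coeff {suc d} f zero = f fzero
coeff {suc d} f (suc e) = coeff (f ∘ fsuc) e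

coeff-cong : ∀ {d} {f g : Fin d → ℕ} → (∀ i → f i ≡ g i) → ∀ e → coeff f e ≡ coeff g e
coeff-cong {zero} h e = refl
coeff-cong {suc d} h zero = h fzero
coeff-cong {suc d} h (suc e) = coeff-cong (h ∘ fsuc) e

coeff-toℕ : ∀ {d} (f : Fin d → ℕ) i → coeff f (toℕ i) ≡ f i
coeff-toℕ f fzero = refl
coeff-toℕ f (fsuc i) = coeff-toℕ (f ∘ fsuc) i

coeff-≥ : ∀ {d} (f : Fin d → ℕ) e → d ≤ e → coeff f e ≡ 0
coeff-≥ {zero} f e _ = refl
coeff-≥ {suc d} f (suc e) (s≤s d≤e) = coeff-≥ (f ∘ fsuc) e d≤e

coeff-zero : ∀ {d} (f : Fin d → ℕ) → (∀ i → f i ≡ 0) → ∀ e → coeff f e ≡ 0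
coeff-zero {zero} f h e = refl
coeff-zero {suc d} f h zero = h fzero
coeff-zero {suc d} f h (suc e) = coeff-zero (f ∘ fsuc) (h ∘ fsuc) e

coeff-suc-at : ∀ {d} (f g : Fin d → ℕ) q → (∀ i → i ≢ q → f i ≡ g i) → suc (f q) ≡ g q →
  ∀ e → coeff f e + δ (toℕ q) e ≡ coeff g e
coeff-suc-at {suc d} f g fzero h sq zero = trans (+-comm (f fzero) 1) sq
coeff-suc-at {suc d} f g fzero h sq (suc e) =
  trans (+-identityʳ _) (coeff-cong (λ i → h (fsuc i) (λ ())) e)
coeff-suc-at {suc d} f g (fsuc q) h sq zero = trans (+-identityʳ _) (h fzero (λ ()))
coeff-suc-at {suc d} f g (fsuc q) h sq (suc e) =
  coeff-suc-at (f ∘ fsuc) (g ∘ fsuc) q (λ i ne → h (fsuc i) (ne ∘ FP.suc-injective)) sq e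

coeff-fromℕ : ∀ {d} (f : Fin (suc d) → ℕ) → f (fromℕ d) ≡ 1 →
  ∀ e → coeff (f ∘ inject₁) e + δ d e ≡ coeff f e
coeff-fromℕ {zero} f h zero = sym h
coeff-fromℕ {zero} f h (suc e) = refl
coeff-fromℕ {suc d} f h zero = +-identityʳ _
coeff-fromℕ {suc d} f h (suc e) = coeff-fromℕ (f ∘ fsuc) h e

coeff-punchIn : ∀ {d} (f : Fin (suc d) → ℕ) a e →
  coeff (f ∘ punchIn a) e ≡ (if e <ᵇ toℕ a then coeff f e else coeff f (suc e))
coeff-punchIn f fzero e = refl
coeff-punchIn {suc d} f (fsuc a) zero = refl
coeff-punchIn {suc d} f (fsuc a) (suc e) = coeff-punchIn (f ∘ fsuc) a e

poly-coeff : ∀ {d} (f : Fin d → ℕ) e → sumP (V.toList (tabulate λ i → monoP (f i) (toℕ i))) e ≡ coeff f e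
poly-coeff {zero} f e = refl
poly-coeff {suc d} f zero = trans (cong (f fzero +_) (shifted-zero (f ∘ fsuc) toℕ)) (+-identityʳ _)
  where
  shifted-zero : ∀ {d'} (g h : Fin d' → ℕ) → sumP (V.toList (tabulate λ i → monoP (g i) (suc (h i)))) zero ≡ 0
  shifted-zero {zero} g h = refl
  shifted-zero {suc d'} g h = shifted-zero (g ∘ fsuc) (h ∘ fsuc)
poly-coeff {suc d} f (suc e) = trans (shifted (f ∘ fsuc) toℕ) (poly-coeff (f ∘ fsuc) e)
  where
  shifted : ∀ {d'} (g h : Fin d' → ℕ) → sumP (V.toList (tabulate λ i → monoP (g i) (suc (h i)))) (suc e)
                                     ≡ sumP (V.toList (tabulate λ i → monoP (g i) (h i))) e
  shifted {zero} g h = refl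
  shifted {suc d'} g h = cong (monoP (g fzero) (h fzero) e +_) (shifted (g ∘ fsuc) (h ∘ fsuc))

toℕ-punchIn-< : ∀ {k} (a : Fin (suc k)) (j : Fin k) → toℕ j < toℕ a → toℕ (punchIn a j) ≡ toℕ j
toℕ-punchIn-< (fsuc a) fzero _ = refl
toℕ-punchIn-< (fsuc a) (fsuc j) (s<s p) = cong suc (toℕ-punchIn-< a j p)

toℕ-punchIn-≥ : ∀ {k} (a : Fin (suc k)) (j : Fin k) → toℕ a ≤ toℕ j → toℕ (punchIn a j) ≡ suc (toℕ j)
toℕ-punchIn-≥ fzero j _ = refl
toℕ-punchIn-≥ (fsuc a) (fsuc j) (s≤s p) = cong suc (toℕ-punchIn-≥ a j p)

toℕ≤toℕ-punchIn : ∀ {k} (a : Fin (suc k)) j → toℕ j ≤ toℕ (punchIn a j)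
toℕ≤toℕ-punchIn a j with toℕ j <? toℕ a
... | yes j<a = ≤-reflexive (sym (toℕ-punchIn-< a j j<a))
... | no j≮a = ≤-trans (n≤1+n _) (≤-reflexive (sym (toℕ-punchIn-≥ a j (≮⇒≥ j≮a))))

toℕ-punchIn-<⇒ : ∀ {k} (a : Fin (suc k)) j → toℕ (punchIn a j) < toℕ a →
  toℕ j < toℕ a × toℕ (punchIn a j) ≡ toℕ j
toℕ-punchIn-<⇒ a j p with toℕ j <? toℕ a
... | yes j<a = j<a , toℕ-punchIn-< a j j<a
... | no j≮a = ⊥-elim (<⇒≱ p (≤-trans (≮⇒≥ j≮a) (toℕ≤toℕ-punchIn a j)))

toℕ-punchIn-≮ : ∀ {k} (a : Fin (suc k)) j → ¬ toℕ (punchIn a j) < toℕ a → toℕ (punchIn a j) ≡ suc (toℕ j)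
toℕ-punchIn-≮ a j p with toℕ j <? toℕ a
... | yes j<a = ⊥-elim (p (subst (_< toℕ a) (sym (toℕ-punchIn-< a j j<a)) j<a))
... | no j≮a = toℕ-punchIn-≥ a j (≮⇒≥ j≮a)

≤toℕ-punchIn⇒≤toℕ : ∀ {k t} (a : Fin (suc k)) j → t ≤ toℕ a → t ≤ toℕ (punchIn a j) → t ≤ toℕ j
≤toℕ-punchIn⇒≤toℕ a j t≤a t≤pj with toℕ j <? toℕ a
... | yes j<a = subst (_ ≤_) (toℕ-punchIn-< a j j<a) t≤pj
... | no j≮a = ≤-trans t≤a (≮⇒≥ j≮a)

punchIn-mono-< : ∀ {k} (a : Fin (suc k)) j j' → toℕ j < toℕ j' → toℕ (punchIn a j) < toℕ (punchIn a j')
punchIn-mono-< a j j' j<j' = ≤∧≢⇒< (FP.punchIn-mono-≤ a j j' (<⇒≤ j<j'))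
  (λ eq → <-irrefl (cong toℕ (FP.punchIn-injective a j j' (FP.toℕ-injective eq))) j<j')

lookup-init : ∀ {k} {A : Set} (v : Vec A (suc k)) i → lookup (init v) i ≡ lookup v (inject₁ i)
lookup-init (x ∷v y ∷v v) fzero = refl
lookup-init (x ∷v y ∷v v) (fsuc i) = lookup-init (y ∷v v) i

lookup-removeAt : ∀ {k} {A : Set} (v : Vec A (suc k)) a i → lookup (removeAt v a) i ≡ lookup v (punchIn a i)
lookup-removeAt (x ∷v v) fzero i = refl
lookup-removeAt (x ∷v y ∷v v) (fsuc a) fzero = refl
lookup-removeAt (x ∷v y ∷v v) (fsuc a) (fsuc i) = lookup-removeAt (y ∷v v) a i

lastEntry≡lookup-fromℕ : ∀ {k} (v : Vec ℕ (suc k)) → lastEntry v ≡ lookup v (fromℕ k)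
lastEntry≡lookup-fromℕ (x ∷v []v) = refl
lastEntry≡lookup-fromℕ (x ∷v y ∷v v) = lastEntry≡lookup-fromℕ (y ∷v v)

lookup-firstPos-< : ∀ {k} (v : Vec ℕ (suc k)) j → toℕ j < toℕ (firstPos v) → lookup v j ≡ 0
lookup-firstPos-< (x ∷v y ∷v v) j p with 0 <ᵇ x in eq
lookup-firstPos-< (x ∷v y ∷v v) j () | true
lookup-firstPos-< (x ∷v y ∷v v) fzero p | false = n≤0⇒n≡0 (≮⇒≥ (λ q → subst T eq (<⇒<ᵇ q)))
lookup-firstPos-< (x ∷v y ∷v v) (fsuc j) (s<s p) | false = lookup-firstPos-< (y ∷v v) j p

lookup-firstPos-pos : ∀ {k} (v : Vec ℕ (suc k)) j → 0 < lookup v j → 0 < lookup v (firstPos v)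
lookup-firstPos-pos (x ∷v []v) fzero p = p
lookup-firstPos-pos (x ∷v y ∷v v) j p with 0 <ᵇ x in eq
... | true = <ᵇ⇒< 0 x (subst T (sym eq) tt)
... | false with j
... | fzero = ⊥-elim (subst T eq (<⇒<ᵇ p))
... | fsuc j' = lookup-firstPos-pos (y ∷v v) j' p

rowSum≡∑ : ∀ {d} (A : Mat d) i → rowSum A i ≡ ∑ (entry A i)
rowSum≡∑ A i = sum≡∑ (lookup A i)

totalSum≡∑ : ∀ {d} (A : Mat d) → totalSum A ≡ ∑ (λ i → ∑ (entry A i))
totalSum≡∑ A = trans (sum≡∑ (V.map V.sum A)) (∑-cong (λ i → trans (VP.lookup-map i V.sum A) (rowSum≡∑ A i)))

lookup-lastCol : ∀ {k} (A : Mat (suc k)) i → lookup (lastCol A) i ≡ entry A i (fromℕ k)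
lookup-lastCol A i = trans (VP.lookup-map i lastEntry A) (lastEntry≡lookup-fromℕ (lookup A i))

entry-rem1-index : ∀ {k} (A : Mat (suc k)) → entry (rem1 A) (indexFin A) (fromℕ k) ≡ pred (val A)
entry-rem1-index {k} A = trans (cong (λ r → lookup r (fromℕ k)) (VP.lookup∘updateAt (indexFin A) A))
                               (VP.lookup∘updateAt (fromℕ k) (lookup A (indexFin A)))

entry-rem1-row : ∀ {k} (A : Mat (suc k)) i j → i ≢ indexFin A → entry (rem1 A) i j ≡ entry A i j
entry-rem1-row A i j i≢a = cong (λ r → lookup r j) (VP.lookup∘updateAt′ i (indexFin A) i≢a A)

entry-rem1-col : ∀ {k} (A : Mat (suc k)) i j → j ≢ fromℕ k → entry (rem1 A) i j ≡ entry A i j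
entry-rem1-col {k} A i j j≢k with i Data.Fin.≟ indexFin A
... | no i≢a = entry-rem1-row A i j i≢a
... | yes refl = trans (cong (λ r → lookup r j) (VP.lookup∘updateAt (indexFin A) A))
                       (VP.lookup∘updateAt′ j (fromℕ k) j≢k (lookup A (indexFin A)))

entry-rem2 : ∀ {k} (A : Mat (suc k)) i j → entry (rem2 A) i j ≡ entry A (inject₁ i) (inject₁ j)
entry-rem2 A i j = trans (cong (λ r → lookup r j) (VP.lookup-map i init (init A)))
  (trans (lookup-init (lookup (init A) i) j)
    (cong (λ r → lookup r (inject₁ j)) (lookup-init A i)))

-- Row r of the matrix built in rem3 before row and column index(A) are deleted.
rem3Row : ∀ {k} (A : Mat (suc k)) → Fin (suc k) → Vec ℕ (suc k)
rem3Row {k} A r = if toℕ r <ᵇ toℕ (indexFin A)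
                  then updateAt (lookup A r) (fromℕ k) (λ _ → entry A r (indexFin A))
                  else lookup A r

entry-rem3 : ∀ {k} (A : Mat (suc k)) i j →
  entry (rem3 A) i j ≡ lookup (rem3Row A (punchIn (indexFin A) i)) (punchIn (indexFin A) j)
entry-rem3 A i j =
  trans (cong (λ r → lookup r j) (VP.lookup-map i (λ row → removeAt row a) (removeAt (tabulate (rem3Row A)) a)))
    (trans (lookup-removeAt (lookup (removeAt (tabulate (rem3Row A)) a) i) a j)
      (cong (λ r → lookup r (punchIn a j))
        (trans (lookup-removeAt (tabulate (rem3Row A)) a i) (VP.lookup∘tabulate (rem3Row A) _))))
  where a = indexFin A

rem3Row-<-last : ∀ {k} (A : Mat (suc k)) r → toℕ r < toℕ (indexFin A) →
  lookup (rem3Row A r) (fromℕ k) ≡ entry A r (indexFin A)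
rem3Row-<-last {k} A r p rewrite <ᵇ-true p = VP.lookup∘updateAt (fromℕ k) (lookup A r)

rem3Row-<-other : ∀ {k} (A : Mat (suc k)) r c → toℕ r < toℕ (indexFin A) → c ≢ fromℕ k →
  lookup (rem3Row A r) c ≡ entry A r c
rem3Row-<-other {k} A r c p c≢k rewrite <ᵇ-true p = VP.lookup∘updateAt′ c (fromℕ k) c≢k (lookup A r)

rem3Row-≮ : ∀ {k} (A : Mat (suc k)) r c → ¬ toℕ r < toℕ (indexFin A) → lookup (rem3Row A r) c ≡ entry A r c
rem3Row-≮ A r c p rewrite <ᵇ-false p = refl

module IntFacts {n k : ℕ} (A : Mat (suc k)) (I : IsInt n A) where
  open IsInt I public

  a : Fin (suc k)
  a = indexFin A

  last : Fin (suc k)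
  last = fromℕ k

  toℕ-last : toℕ last ≡ k
  toℕ-last = FP.toℕ-fromℕ k

  toℕ≤k : ∀ (i : Fin (suc k)) → toℕ i ≤ k
  toℕ≤k i = ≤-pred (FP.toℕ<n i)

  val-pos : 0 < entry A a last
  val-pos with colsNonzero last
  ... | i , p = subst (0 <_) (lookup-lastCol A a)
      (lookup-firstPos-pos (lastCol A) i (subst (0 <_) (sym (lookup-lastCol A i)) p))

  above-index : ∀ i → toℕ i < toℕ a → entry A i last ≡ 0
  above-index i p = trans (sym (lookup-lastCol A i)) (lookup-firstPos-< (lastCol A) i p)

  entry≤rowSum : ∀ i j → entry A i j ≤ rowSum A i
  entry≤rowSum i j = subst (entry A i j ≤_) (sym (rowSum≡∑ A i)) (f≤∑ (entry A i) j)

  rowSum-pos : ∀ i → 0 < rowSum A i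
  rowSum-pos i with rowsNonzero i
  ... | j , p = <-≤-trans p (entry≤rowSum i j)

  lastRow-zero : ∀ j → j ≢ last → entry A last j ≡ 0
  lastRow-zero j j≢last = upperTriangular last j (subst (toℕ j <_) (sym toℕ-last)
    (≤∧≢⇒< (toℕ≤k j) (λ eq → j≢last (FP.toℕ-injective (trans eq (sym toℕ-last))))))

  rowSum-last : rowSum A last ≡ entry A last last
  rowSum-last = begin
    rowSum A last                                      ≡⟨ rowSum≡∑ A last ⟩
    ∑ (entry A last)                                   ≡⟨ ∑-punchIn (entry A last) last ⟩
    entry A last last + ∑ (entry A last ∘ punchIn last) ≡⟨ cong (entry A last last +_) (∑-zero _ offDiag) ⟩
    entry A last last + 0                              ≡⟨ +-identityʳ _ ⟩
    entry A last last ∎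
    where
    open ≡-Reasoning
    offDiag : ∀ j → entry A last (punchIn last j) ≡ 0
    offDiag j = lastRow-zero (punchIn last j) (FP.punchInᵢ≢i last j)

  diagonal-last-pos : 0 < entry A last last
  diagonal-last-pos = subst (0 <_) rowSum-last (rowSum-pos last)

  dim≤n : suc k ≤ n
  dim≤n = subst (suc k ≤_) (trans (sym (totalSum≡∑ A)) sumIsN)
    (∀-pos⇒d≤∑ (λ i → ∑ (entry A i)) (λ i → subst (0 <_) (rowSum≡∑ A i) (rowSum-pos i)))

SplitsAt : ∀ {d} → ℕ → Mat d → Set
SplitsAt {d} t A = ∀ (i j : Fin d) → toℕ i < t → t ≤ toℕ j → entry A i j ≡ 0

SplitsAt? : ∀ {d} t (A : Mat d) → Dec (SplitsAt t A)
SplitsAt? t A = FP.all? λ i → FP.all? λ j → (toℕ i <? t) →-dec ((t ≤? toℕ j) →-dec (entry A i j ≟ 0))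

-- What Γ(A) remembers about A, kept invariant by the removal operation.
record Correspondence (x : List ℕ) (k : ℕ) (A : Mat (suc k)) : Set where
  field
    prefix          : List ℕ
    x≡prefix∷ʳindex : x ≡ prefix ∷ʳ toℕ (indexFin A)
    zeros≡          : zeros x ≡ rowSum A fzero
    asc≡            : asc x ≡ k
    multiplicity    : ∀ e → qSum (hat x) e ≡ coeff (rowSum A) e
    rmaxMultiplicity : ∀ e → qSum (rmaxValues (hat x)) e ≡ coeff (λ i → entry A i (fromℕ k)) e
    cut⇒split       : ∀ t → 0 < t → t ≤ k → CutAt t (hat x) → SplitsAt t A
    split⇒cut       : ∀ t → 0 < t → t ≤ k → SplitsAt t A → CutAt t (hat x)

module CorrespondenceFacts {n x k} (A : Mat (suc k)) (I : IsInt n A) (C : Correspondence x k A) where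
  open Correspondence C

  hat-values : ∀ e → e < suc k → e ∈ hat x
  hat-values e e<d with fromℕ< e<d | FP.toℕ-fromℕ< e<d
  ... | i | refl = qSum-pos⇒∈ (hat x) (toℕ i)
    (subst (0 <_) (sym (trans (multiplicity (toℕ i)) (coeff-toℕ (rowSum A) i))) (IntFacts.rowSum-pos A I i))

  hat-< : All (_< suc k) (hat x)
  hat-< = qSum-zero⇒All< (hat x) (suc k) (λ e d≤e → trans (multiplicity e) (coeff-≥ (rowSum A) e d≤e))

  hat-∷ʳ-index : ∀ v → hat (x ∷ʳ v) ≡
    (if toℕ (indexFin A) <ᵇ v then map (bump v) (hat x) else hat x) ∷ʳ v
  hat-∷ʳ-index v rewrite x≡prefix∷ʳindex = hat-∷ʳ prefix (toℕ (indexFin A)) v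

  asc-∷ʳ-index : ∀ v → asc (x ∷ʳ v) ≡ k + isAscent (toℕ (indexFin A)) v
  asc-∷ʳ-index v rewrite x≡prefix∷ʳindex =
    trans (asc-∷ʳ prefix (toℕ (indexFin A)) v)
          (cong (_+ isAscent (toℕ (indexFin A)) v) (trans (cong asc (sym x≡prefix∷ʳindex)) asc≡))

qSum-rmaxValues-∷ʳ : ∀ w a e →
  qSum (rmaxValues (w ∷ʳ a)) e ≡ (if e <ᵇ a then 0 else qSum (rmaxValues w) e) + δ a e
qSum-rmaxValues-∷ʳ w a e = begin
  qSum (rmaxValues (w ∷ʳ a)) e                  ≡⟨ cong (λ z → qSum z e) (rmaxValues-∷ʳ w a) ⟩
  qSum (atLeast a (rmaxValues w) ∷ʳ a) e        ≡⟨ qSum-∷ʳ (atLeast a (rmaxValues w)) a e ⟩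
  qSum (atLeast a (rmaxValues w)) e + δ a e     ≡⟨ cong (_+ δ a e) (qSum-atLeast a (rmaxValues w) e) ⟩
  (if e <ᵇ a then 0 else qSum (rmaxValues w) e) + δ a e ∎
  where open ≡-Reasoning

-- Case (Rem1): A arises from f(A) by adding one to entry (index(A), dim A).

module Rem1 {m k : ℕ} (A : Mat (suc k)) (I : IsInt (suc (suc m)) A)
            (cond : 1 < val A ⊎ val A < rowSum A (indexFin A)) where
  open IntFacts A I
  A' = rem1 A

  entry-rem1-≤ : ∀ i j → entry A' i j ≤ entry A i j
  entry-rem1-≤ i j with i Data.Fin.≟ a | j Data.Fin.≟ last
  ... | no i≢a | _ = ≤-reflexive (entry-rem1-row A i j i≢a)
  ... | yes _ | no j≢last = ≤-reflexive (entry-rem1-col A i j j≢last)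
  ... | yes refl | yes refl = ≤-trans (≤-reflexive (entry-rem1-index A)) pred[n]≤n

  pred-pos : ∀ {v} → 1 < v → 0 < pred v
  pred-pos {suc (suc _)} _ = z<s
  pred-pos {suc zero} (s<s ())

  suc-entry-index : suc (entry A' a last) ≡ entry A a last
  suc-entry-index = trans (cong suc (entry-rem1-index A)) (suc-pred (entry A a last) ⦃ >-nonZero val-pos ⦄)

  rowSum-other : ∀ i → i ≢ a → rowSum A' i ≡ rowSum A i
  rowSum-other i i≢a = trans (rowSum≡∑ A' i) (trans (∑-cong (λ j → entry-rem1-row A i j i≢a)) (sym (rowSum≡∑ A i)))

  suc-rowSum-index : suc (rowSum A' a) ≡ rowSum A a
  suc-rowSum-index = trans (cong suc (rowSum≡∑ A' a))
    (trans (∑-suc-at (entry A' a) (entry A a) last (entry-rem1-col A a) suc-entry-index) (sym (rowSum≡∑ A a)))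

  suc-totalSum : suc (totalSum A') ≡ totalSum A
  suc-totalSum = trans (cong suc (totalSum≡∑ A')) (trans (∑-suc-at _ _ a
    (λ i i≢a → trans (sym (rowSum≡∑ A' i)) (trans (rowSum-other i i≢a) (rowSum≡∑ A i)))
    (trans (cong suc (sym (rowSum≡∑ A' a))) (trans suc-rowSum-index (rowSum≡∑ A a)))) (sym (totalSum≡∑ A)))

  rowNonzero-index : ∃[ j ] (0 < entry A' a j)
  rowNonzero-index = from cond
    where
    from : 1 < val A ⊎ val A < rowSum A a → ∃[ j ] (0 < entry A' a j)
    from (inj₁ 1<val) = last , subst (0 <_) (sym (entry-rem1-index A)) (pred-pos 1<val)
    from (inj₂ val<row) with ∑-pos⇒∃ (entry A a ∘ punchIn last) (+-cancelˡ-< (val A) 0 _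
        (subst (val A + 0 <_) (trans (rowSum≡∑ A a) (∑-punchIn (entry A a) last))
          (subst (_< rowSum A a) (sym (+-identityʳ _)) val<row)))
    ... | j , p = punchIn last j , subst (0 <_) (sym (entry-rem1-col A a _ (FP.punchInᵢ≢i last j))) p

  -- If val(A) = 1 then index(A) is not the last row, whose row sum is its diagonal entry.
  index≢last : ¬ 1 < val A → last ≢ a
  index≢last val≤1 last≡a = from cond
    where
    from : 1 < val A ⊎ val A < rowSum A a → ⊥
    from (inj₁ 1<val) = val≤1 1<val
    from (inj₂ val<row) = <-irrefl (sym (subst (λ r → rowSum A r ≡ entry A r last) last≡a rowSum-last)) val<row

  colNonzero-last : ∃[ i ] (0 < entry A' i last)
  colNonzero-last with 1 <? val A
  ... | yes 1<val = a , subst (0 <_) (sym (entry-rem1-index A)) (pred-pos 1<val)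
  ... | no val≤1 = last , subst (0 <_) (sym (entry-rem1-row A last last (index≢last val≤1))) diagonal-last-pos

  isInt : IsInt (suc m) A'
  isInt = record
    { upperTriangular = λ i j j<i → n≤0⇒n≡0 (≤-trans (entry-rem1-≤ i j) (≤-reflexive (upperTriangular i j j<i)))
    ; sumIsN = suc-injective (trans suc-totalSum sumIsN)
    ; rowsNonzero = rowsNZ
    ; colsNonzero = colsNZ }
    where
    rowsNZ : ∀ i → ∃[ j ] (0 < entry A' i j)
    rowsNZ i with i Data.Fin.≟ a
    ... | yes refl = rowNonzero-index
    ... | no i≢a with rowsNonzero i
    ... | j , p = j , subst (0 <_) (sym (entry-rem1-row A i j i≢a)) p
    colsNZ : ∀ j → ∃[ i ] (0 < entry A' i j)
    colsNZ j with j Data.Fin.≟ last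
    ... | yes refl = colNonzero-last
    ... | no j≢last with colsNonzero j
    ... | i , p = i , subst (0 <_) (sym (entry-rem1-col A i j j≢last)) p

  module _ (x : List ℕ) (C : Correspondence x k A') where
    open Correspondence C
    open CorrespondenceFacts A' isInt C

    index-rem1-≮ : ¬ toℕ (indexFin A') < toℕ a
    index-rem1-≮ lt = <-irrefl
      (sym (trans (entry-rem1-row A (indexFin A') last (λ eq → <-irrefl (cong toℕ eq) lt)) (above-index _ lt)))
      (IntFacts.val-pos A' isInt)

    hat-x∷ʳa : hat (x ∷ʳ toℕ a) ≡ hat x ∷ʳ toℕ a
    hat-x∷ʳa = trans (hat-∷ʳ-index (toℕ a)) (cong (_∷ʳ toℕ a) (if-≮ _ _ index-rem1-≮))

    rmaxMultiplicity-∷ʳ : ∀ e →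
      (if e <ᵇ toℕ a then 0 else qSum (rmaxValues (hat x)) e) + δ (toℕ a) e ≡ coeff (λ i → entry A i last) e
    rmaxMultiplicity-∷ʳ e with e <? toℕ a
    ... | yes e<a with fromℕ< (<-trans e<a (FP.toℕ<n a)) | FP.toℕ-fromℕ< (<-trans e<a (FP.toℕ<n a))
    ... | i | refl = trans (cong₂ _+_ (if-< _ _ e<a) (δ-≢ (λ q → <-irrefl (sym q) e<a)))
                       (sym (trans (coeff-toℕ _ i) (above-index i e<a)))
    rmaxMultiplicity-∷ʳ e | no e≮a = trans (cong (_+ δ (toℕ a) e) (trans (if-≮ _ _ e≮a) (rmaxMultiplicity e)))
      (coeff-suc-at (λ i → entry A' i last) (λ i → entry A i last) a (λ i i≢a → entry-rem1-row A i last i≢a)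
        suc-entry-index e)

    unchanged-above : ∀ {t} → t ≤ toℕ a → ∀ i j → toℕ i < t → entry A' i j ≡ entry A i j
    unchanged-above t≤a i j i<t = entry-rem1-row A i j (λ { refl → <⇒≱ i<t t≤a })

    cut⇒split-step : ∀ t → 0 < t → t ≤ k → CutAt t (hat (x ∷ʳ toℕ a)) → SplitsAt t A
    cut⇒split-step t 0<t t≤k cut with t ≤? toℕ a
    ... | yes t≤a = λ i j i<t t≤j → trans (sym (unchanged-above t≤a i j i<t))
            (cut⇒split t 0<t t≤k (CutAt-++⁻ˡ t (hat x) (toℕ a ∷ []) (subst (CutAt t) hat-x∷ʳa cut)) i j i<t t≤j)
    ... | no t≰a = ⊥-elim (∈⇒¬All< (hat x) (hat-values k (n<1+n k)) t≤k
            (CutAt-∷ʳ⁻ t (hat x) (toℕ a) (subst (CutAt t) hat-x∷ʳa cut) (≰⇒> t≰a)))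

    split⇒cut-step : ∀ t → 0 < t → t ≤ k → SplitsAt t A → CutAt t (hat (x ∷ʳ toℕ a))
    split⇒cut-step t 0<t t≤k split with t ≤? toℕ a
    ... | yes t≤a = subst (CutAt t) (sym hat-x∷ʳa) (CutAt-∷ʳ t (hat x) (toℕ a)
            (split⇒cut t 0<t t≤k (λ i j i<t t≤j → trans (unchanged-above t≤a i j i<t) (split i j i<t t≤j))) t≤a)
    ... | no t≰a = ⊥-elim (<-irrefl (sym (split a last (≰⇒> t≰a) (subst (t ≤_) (sym toℕ-last) t≤k))) val-pos)

    correspondence : Correspondence (x ∷ʳ toℕ a) k A
    correspondence = record
      { prefix = x
      ; x≡prefix∷ʳindex = refl
      ; zeros≡ = trans (zeros-∷ʳ x (toℕ a)) (trans (cong (_+ δ (toℕ a) 0) zeros≡)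
          (coeff-suc-at (rowSum A') (rowSum A) a rowSum-other suc-rowSum-index 0))
      ; asc≡ = trans (asc-∷ʳ-index (toℕ a)) (trans (cong (k +_) (if-≮ 1 0 index-rem1-≮)) (+-identityʳ k))
      ; multiplicity = λ e → trans (cong (λ z → qSum z e) hat-x∷ʳa) (trans (qSum-∷ʳ (hat x) (toℕ a) e)
          (trans (cong (_+ δ (toℕ a) e) (multiplicity e)) (coeff-suc-at _ _ a rowSum-other suc-rowSum-index e)))
      ; rmaxMultiplicity = λ e → trans (cong (λ z → qSum (rmaxValues z) e) hat-x∷ʳa)
          (trans (qSum-rmaxValues-∷ʳ (hat x) (toℕ a) e) (rmaxMultiplicity-∷ʳ e))
      ; cut⇒split = cut⇒split-step
      ; split⇒cut = split⇒cut-step }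

-- Case (Rem2): A arises from f(A) by appending the row and column (0 … 0 1).

module Rem2 {m k' : ℕ} (A : Mat (suc (suc k'))) (I : IsInt (suc (suc m)) A)
            (index≡k : toℕ (indexFin A) ≡ suc k') (val≡1 : val A ≡ 1) where
  open IntFacts A I
  k = suc k'
  A' = rem2 A

  a≡last : a ≡ last
  a≡last = FP.toℕ-injective (trans index≡k (sym toℕ-last))

  ≢last⇒<k : ∀ (i : Fin (suc k)) → i ≢ last → toℕ i < k
  ≢last⇒<k i i≢last = ≤∧≢⇒< (toℕ≤k i) (λ eq → i≢last (FP.toℕ-injective (trans eq (sym toℕ-last))))

  lastCol-zero : ∀ i → i ≢ last → entry A i last ≡ 0
  lastCol-zero i i≢last = above-index i (subst (toℕ i <_) (sym index≡k) (≢last⇒<k i i≢last))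

  inject₁≢last : ∀ (i : Fin k) → inject₁ i ≢ last
  inject₁≢last i eq = FP.fromℕ≢inject₁ (sym eq)

  lower : ∀ (j : Fin (suc k)) → toℕ j < k → Σ (Fin k) λ j' → inject₁ j' ≡ j
  lower j j<k = lower₁ j (λ eq → <-irrefl (sym eq) j<k) , FP.inject₁-lower₁ j _

  rowSum-rem2 : ∀ i → rowSum A' i ≡ rowSum A (inject₁ i)
  rowSum-rem2 i = begin
    rowSum A' i                                        ≡⟨ rowSum≡∑ A' i ⟩
    ∑ (entry A' i)                                     ≡⟨ ∑-cong (entry-rem2 A i) ⟩
    ∑ (entry A (inject₁ i) ∘ inject₁)                  ≡⟨ +-identityʳ _ ⟨
    ∑ (entry A (inject₁ i) ∘ inject₁) + 0
      ≡⟨ cong (∑ (entry A (inject₁ i) ∘ inject₁) +_) (lastCol-zero (inject₁ i) (inject₁≢last i)) ⟨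
    ∑ (entry A (inject₁ i) ∘ inject₁) + entry A (inject₁ i) last ≡⟨ ∑-fromℕ (entry A (inject₁ i)) ⟨
    ∑ (entry A (inject₁ i))                            ≡⟨ rowSum≡∑ A (inject₁ i) ⟨
    rowSum A (inject₁ i) ∎
    where open ≡-Reasoning

  lastEntry≡1 : entry A last last ≡ 1
  lastEntry≡1 = trans (cong (λ r → entry A r last) (sym a≡last)) val≡1

  rowSum-last≡1 : rowSum A last ≡ 1
  rowSum-last≡1 = trans rowSum-last lastEntry≡1

  suc-totalSum : suc (totalSum A') ≡ totalSum A
  suc-totalSum = sym (begin
    totalSum A                                        ≡⟨ totalSum≡∑ A ⟩
    ∑ (λ i → ∑ (entry A i))                           ≡⟨ ∑-fromℕ (λ i → ∑ (entry A i)) ⟩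
    ∑ (λ i → ∑ (entry A (inject₁ i))) + ∑ (entry A last) ≡⟨ cong₂ _+_ (∑-cong rows) (trans (sym (rowSum≡∑ A last)) rowSum-last≡1) ⟩
    ∑ (λ i → ∑ (entry A' i)) + 1                      ≡⟨ cong (_+ 1) (totalSum≡∑ A') ⟨
    totalSum A' + 1                                   ≡⟨ +-comm _ 1 ⟩
    suc (totalSum A') ∎)
    where
    open ≡-Reasoning
    rows : ∀ i → ∑ (entry A (inject₁ i)) ≡ ∑ (entry A' i)
    rows i = trans (sym (rowSum≡∑ A (inject₁ i))) (trans (sym (rowSum-rem2 i)) (rowSum≡∑ A' i))

  isInt : IsInt (suc m) A'
  isInt = record
    { upperTriangular = λ i j j<i → trans (entry-rem2 A i j) (upperTriangular (inject₁ i) (inject₁ j)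
        (subst₂ _<_ (sym (FP.toℕ-inject₁ j)) (sym (FP.toℕ-inject₁ i)) j<i))
    ; sumIsN = suc-injective (trans suc-totalSum sumIsN)
    ; rowsNonzero = rowsNZ
    ; colsNonzero = colsNZ }
    where
    rowsNZ : ∀ i → ∃[ j ] (0 < entry A' i j)
    rowsNZ i with rowsNonzero (inject₁ i)
    ... | j , p with j Data.Fin.≟ last
    ... | yes refl = ⊥-elim (<-irrefl (sym (lastCol-zero (inject₁ i) (inject₁≢last i))) p)
    ... | no j≢last with lower j (≢last⇒<k j j≢last)
    ... | j' , refl = j' , subst (0 <_) (sym (entry-rem2 A i j')) p
    colsNZ : ∀ j → ∃[ i ] (0 < entry A' i j)
    colsNZ j with colsNonzero (inject₁ j)
    ... | i , p with toℕ (inject₁ j) <? toℕ i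
    ... | yes j<i = ⊥-elim (<-irrefl (sym (upperTriangular i (inject₁ j) j<i)) p)
    ... | no j≮i with lower i (≤-<-trans (≮⇒≥ j≮i) (subst (_< k) (sym (FP.toℕ-inject₁ j)) (FP.toℕ<n j)))
    ... | i' , refl = i' , subst (0 <_) (sym (entry-rem2 A i' j)) p

  splitsAt⁺ : ∀ t → t ≤ k → (t ≤ k' → SplitsAt t A') → SplitsAt t A
  splitsAt⁺ t t≤k split i j i<t t≤j with j Data.Fin.≟ last
  ... | yes refl = lastCol-zero i (λ eq → <-irrefl (trans (cong toℕ eq) toℕ-last) (<-≤-trans i<t t≤k))
  ... | no j≢last with lower j (≢last⇒<k j j≢last) | lower i (<-≤-trans i<t t≤k)
  ... | j' , refl | i' , refl = trans (sym (entry-rem2 A i' j'))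
      (split (≤-pred (≤-<-trans t≤j (≢last⇒<k _ j≢last))) i' j'
         (subst (_< t) (FP.toℕ-inject₁ i') i<t) (subst (t ≤_) (FP.toℕ-inject₁ j') t≤j))

  splitsAt⁻ : ∀ t → SplitsAt t A → SplitsAt t A'
  splitsAt⁻ t split i j i<t t≤j = trans (entry-rem2 A i j) (split (inject₁ i) (inject₁ j)
    (subst (_< t) (sym (FP.toℕ-inject₁ i)) i<t) (subst (t ≤_) (sym (FP.toℕ-inject₁ j)) t≤j))

  module _ (x : List ℕ) (C : Correspondence x k' A') where
    open Correspondence C
    open CorrespondenceFacts A' isInt C

    index'<a : toℕ (indexFin A') < toℕ a
    index'<a = subst (toℕ (indexFin A') <_) (sym index≡k) (FP.toℕ<n (indexFin A'))

    hat-x∷ʳa : hat (x ∷ʳ toℕ a) ≡ hat x ∷ʳ toℕ a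
    hat-x∷ʳa = trans (hat-∷ʳ-index (toℕ a)) (cong (_∷ʳ toℕ a)
      (trans (if-< _ _ index'<a) (trans (cong (λ z → map (bump z) (hat x)) index≡k) (map-bump-id k (hat x) hat-<))))

    rmaxMultiplicity-∷ʳ : ∀ e →
      (if e <ᵇ toℕ a then 0 else qSum (rmaxValues (hat x)) e) + δ (toℕ a) e ≡ coeff (λ i → entry A i last) e
    rmaxMultiplicity-∷ʳ e = begin
      (if e <ᵇ toℕ a then 0 else qSum (rmaxValues (hat x)) e) + δ (toℕ a) e
        ≡⟨ cong₂ _+_ earlier (cong (λ z → δ z e) index≡k) ⟩
      0 + δ k e
        ≡⟨ cong (_+ δ k e) (coeff-zero _ (λ i → lastCol-zero (inject₁ i) (inject₁≢last i)) e) ⟨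
      coeff (λ i → entry A (inject₁ i) last) e + δ k e
        ≡⟨ coeff-fromℕ (λ i → entry A i last) lastEntry≡1 e ⟩
      coeff (λ i → entry A i last) e ∎
      where
      open ≡-Reasoning
      earlier : (if e <ᵇ toℕ a then 0 else qSum (rmaxValues (hat x)) e) ≡ 0
      earlier with e <? toℕ a
      ... | yes e<a = if-< _ _ e<a
      ... | no e≮a = trans (if-≮ _ _ e≮a)
          (All<⇒qSum-zero (rmaxValues (hat x)) e (rmaxValues-All (hat x) hat-<) (subst (_≤ e) index≡k (≮⇒≥ e≮a)))

    cut⇒split-step : ∀ t → 0 < t → t ≤ k → CutAt t (hat (x ∷ʳ toℕ a)) → SplitsAt t A
    cut⇒split-step t 0<t t≤k cut = splitsAt⁺ t t≤k (λ t≤k' → cut⇒split t 0<t t≤k'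
      (CutAt-++⁻ˡ t (hat x) (toℕ a ∷ []) (subst (CutAt t) hat-x∷ʳa cut)))

    split⇒cut-step : ∀ t → 0 < t → t ≤ k → SplitsAt t A → CutAt t (hat (x ∷ʳ toℕ a))
    split⇒cut-step t 0<t t≤k split =
      subst (CutAt t) (sym hat-x∷ʳa) (CutAt-∷ʳ t (hat x) (toℕ a) cut-x (subst (t ≤_) (sym index≡k) t≤k))
      where
      cut-x : CutAt t (hat x)
      cut-x with t ≤? k'
      ... | yes t≤k' = split⇒cut t 0<t t≤k' (splitsAt⁻ t split)
      ... | no t≰k' = All<⇒CutAt t (hat x) (All.map (λ p → <-≤-trans p (≰⇒> t≰k')) hat-<)

    correspondence : Correspondence (x ∷ʳ toℕ a) k A
    correspondence = record
      { prefix = x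
      ; x≡prefix∷ʳindex = refl
      ; zeros≡ = trans (zeros-∷ʳ x (toℕ a)) (trans (cong₂ _+_ zeros≡ (cong isZero index≡k))
          (trans (+-identityʳ _) (rowSum-rem2 fzero)))
      ; asc≡ = trans (asc-∷ʳ-index (toℕ a)) (trans (cong (k' +_) (if-< 1 0 index'<a)) (+-comm k' 1))
      ; multiplicity = λ e → trans (cong (λ z → qSum z e) hat-x∷ʳa) (trans (qSum-∷ʳ (hat x) (toℕ a) e)
          (trans (cong₂ _+_ (trans (multiplicity e) (coeff-cong rowSum-rem2 e)) (cong (λ z → δ z e) index≡k))
            (coeff-fromℕ (rowSum A) rowSum-last≡1 e)))
      ; rmaxMultiplicity = λ e → trans (cong (λ z → qSum (rmaxValues z) e) hat-x∷ʳa)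
          (trans (qSum-rmaxValues-∷ʳ (hat x) (toℕ a) e) (rmaxMultiplicity-∷ʳ e))
      ; cut⇒split = cut⇒split-step
      ; split⇒cut = split⇒cut-step }

-- Case (Rem3): A arises from f(A) by inserting row and column index(A), moving
-- the entries above index(A) of the last column into the new column.

module Rem3 {m k' : ℕ} (A : Mat (suc (suc k'))) (I : IsInt (suc (suc m)) A)
            (index<k : toℕ (indexFin A) < suc k') (val≡1 : val A ≡ 1)
            (rowSum≤1 : rowSum A (indexFin A) ≤ 1) where
  open IntFacts A I
  k = suc k'
  A' = rem3 A
  last' : Fin k
  last' = fromℕ k'
  p : Fin k → Fin (suc k)
  p = punchIn a

  a≢last : a ≢ last
  a≢last eq = <-irrefl (trans (cong toℕ eq) toℕ-last) index<k

  indexRow-zero : ∀ j → j ≢ last → entry A a j ≡ 0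
  indexRow-zero j j≢last = subst (λ z → entry A a z ≡ 0) (FP.punchIn-punchOut (j≢last ∘ sym))
    (∑≡0⇒zero (entry A a ∘ punchIn last) others≡0 (punchOut (j≢last ∘ sym)))
    where
    others≡0 : ∑ (entry A a ∘ punchIn last) ≡ 0
    others≡0 = n≤0⇒n≡0 (+-cancelˡ-≤ 1 _ 0 (subst (_≤ 1)
      (trans (rowSum≡∑ A a) (trans (∑-punchIn (entry A a) last) (cong (_+ ∑ (entry A a ∘ punchIn last)) val≡1)))
      (subst (rowSum A a ≤_) (sym (+-identityʳ 1)) rowSum≤1)))

  rowSum-index≡1 : rowSum A a ≡ 1
  rowSum-index≡1 = ≤-antisym rowSum≤1 (subst (_≤ rowSum A a) val≡1 (entry≤rowSum a last))

  indexCol-nonzero : ∃[ i ] (toℕ i < toℕ a × 0 < entry A i a)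
  indexCol-nonzero with colsNonzero a
  ... | i , q with <-cmp (toℕ i) (toℕ a)
  ... | tri< i<a _ _ = i , i<a , q
  ... | tri≈ _ i≡a _ = ⊥-elim (<-irrefl (sym (subst (λ r → entry A r a ≡ 0) (sym (FP.toℕ-injective i≡a))
                          (indexRow-zero a a≢last))) q)
  ... | tri> _ _ i>a = ⊥-elim (<-irrefl (sym (upperTriangular i a i>a)) q)

  0<index : 0 < toℕ a
  0<index = ≤-<-trans z≤n (proj₁ (proj₂ indexCol-nonzero))

  p-last' : p last' ≡ last
  p-last' = FP.toℕ-injective (trans (toℕ-punchIn-≥ a last' (subst (toℕ a ≤_) (sym (FP.toℕ-fromℕ k')) (≤-pred index<k)))
    (trans (cong suc (FP.toℕ-fromℕ k')) (sym toℕ-last)))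

  p-≢last : ∀ j → j ≢ last' → p j ≢ last
  p-≢last j j≢last' eq = j≢last' (FP.punchIn-injective a j last' (trans eq (sym p-last')))

  p≢a : ∀ i → toℕ (p i) ≢ toℕ a
  p≢a i eq = FP.punchInᵢ≢i a i (FP.toℕ-injective eq)

  ≮a⇒>a : ∀ i → ¬ toℕ (p i) < toℕ a → toℕ a < toℕ (p i)
  ≮a⇒>a i ≮a = ≤∧≢⇒< (≮⇒≥ ≮a) (p≢a i ∘ sym)

  entry-copied : ∀ i → toℕ (p i) < toℕ a → entry A' i last' ≡ entry A (p i) a
  entry-copied i lt = trans (entry-rem3 A i last') (trans (cong (lookup (rem3Row A (p i))) p-last') (rem3Row-<-last A (p i) lt))

  entry-other : ∀ i j → j ≢ last' → entry A' i j ≡ entry A (p i) (p j)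
  entry-other i j j≢last' with toℕ (p i) <? toℕ a
  ... | yes lt = trans (entry-rem3 A i j) (rem3Row-<-other A (p i) (p j) lt (p-≢last j j≢last'))
  ... | no ≮a = trans (entry-rem3 A i j) (rem3Row-≮ A (p i) (p j) ≮a)

  entry-below : ∀ i j → ¬ toℕ (p i) < toℕ a → entry A' i j ≡ entry A (p i) (p j)
  entry-below i j ≮a = trans (entry-rem3 A i j) (rem3Row-≮ A (p i) (p j) ≮a)

  rowSum-rem3 : ∀ i → rowSum A' i ≡ rowSum A (p i)
  rowSum-rem3 i with toℕ (p i) <? toℕ a
  ... | yes lt = begin
    rowSum A' i                            ≡⟨ rowSum≡∑ A' i ⟩
    ∑ (entry A' i)                         ≡⟨ +-identityʳ _ ⟨
    ∑ (entry A' i) + 0                     ≡⟨ cong (∑ (entry A' i) +_) (above-index (p i) lt) ⟨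
    ∑ (entry A' i) + entry A (p i) last    ≡⟨ cong (λ z → ∑ (entry A' i) + entry A (p i) z) p-last' ⟨
    ∑ (entry A' i) + entry A (p i) (p last') ≡⟨ ∑-update (entry A' i) (entry A (p i) ∘ p) last' (entry-other i) ⟩
    ∑ (entry A (p i) ∘ p) + entry A' i last' ≡⟨ cong (∑ (entry A (p i) ∘ p) +_) (entry-copied i lt) ⟩
    ∑ (entry A (p i) ∘ p) + entry A (p i) a  ≡⟨ +-comm _ (entry A (p i) a) ⟩
    entry A (p i) a + ∑ (entry A (p i) ∘ p)  ≡⟨ ∑-punchIn (entry A (p i)) a ⟨
    ∑ (entry A (p i))                      ≡⟨ rowSum≡∑ A (p i) ⟨
    rowSum A (p i) ∎
    where open ≡-Reasoning
  ... | no ≮a = begin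
    rowSum A' i                            ≡⟨ rowSum≡∑ A' i ⟩
    ∑ (entry A' i)                         ≡⟨ ∑-cong (λ j → entry-below i j ≮a) ⟩
    ∑ (entry A (p i) ∘ p)                  ≡⟨ cong (_+ ∑ (entry A (p i) ∘ p)) (upperTriangular (p i) a (≮a⇒>a i ≮a)) ⟨
    entry A (p i) a + ∑ (entry A (p i) ∘ p)  ≡⟨ ∑-punchIn (entry A (p i)) a ⟨
    ∑ (entry A (p i))                      ≡⟨ rowSum≡∑ A (p i) ⟨
    rowSum A (p i) ∎
    where open ≡-Reasoning

  suc-totalSum : suc (totalSum A') ≡ totalSum A
  suc-totalSum = sym (begin
    totalSum A                                      ≡⟨ totalSum≡∑ A ⟩
    ∑ (λ i → ∑ (entry A i))                         ≡⟨ ∑-punchIn (λ i → ∑ (entry A i)) a ⟩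
    ∑ (entry A a) + ∑ (λ i → ∑ (entry A (p i)))     ≡⟨ cong₂ _+_ (trans (sym (rowSum≡∑ A a)) rowSum-index≡1) (∑-cong rows) ⟩
    1 + ∑ (λ i → ∑ (entry A' i))                    ≡⟨ cong suc (totalSum≡∑ A') ⟨
    suc (totalSum A') ∎)
    where
    open ≡-Reasoning
    rows : ∀ i → ∑ (entry A (p i)) ≡ ∑ (entry A' i)
    rows i = trans (sym (rowSum≡∑ A (p i))) (trans (sym (rowSum-rem3 i)) (rowSum≡∑ A' i))

  colNonzero-last' : ∃[ i ] (toℕ (p i) < toℕ a × 0 < entry A' i last')
  colNonzero-last' with indexCol-nonzero
  ... | i , i<a , q = i' , pi'<a , subst (0 <_) (sym (entry-copied i' pi'<a)) (subst (λ z → 0 < entry A z a) (sym pi'≡i) q)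
    where
    a≢i : a ≢ i
    a≢i eq = <-irrefl (cong toℕ (sym eq)) i<a
    i' = punchOut a≢i
    pi'≡i : p i' ≡ i
    pi'≡i = FP.punchIn-punchOut a≢i
    pi'<a : toℕ (p i') < toℕ a
    pi'<a = subst (λ z → toℕ z < toℕ a) (sym pi'≡i) i<a

  above-if-nonzero : ∀ i → 0 < entry A (p i) a → toℕ (p i) < toℕ a
  above-if-nonzero i q with toℕ (p i) <? toℕ a
  ... | yes lt = lt
  ... | no ≮a = ⊥-elim (<-irrefl (sym (upperTriangular (p i) a (≮a⇒>a i ≮a))) q)

  isInt : IsInt (suc m) A'
  isInt = record
    { upperTriangular = ut
    ; sumIsN = suc-injective (trans suc-totalSum sumIsN)
    ; rowsNonzero = rowsNZ
    ; colsNonzero = colsNZ }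
    where
    ut : ∀ i j → toℕ j < toℕ i → entry A' i j ≡ 0
    ut i j j<i with j Data.Fin.≟ last'
    ... | yes refl = ⊥-elim (<⇒≱ j<i (subst (toℕ i ≤_) (sym (FP.toℕ-fromℕ k')) (≤-pred (FP.toℕ<n i))))
    ... | no j≢last' = trans (entry-other i j j≢last') (upperTriangular (p i) (p j) (punchIn-mono-< a j i j<i))
    rowsNZ : ∀ i → ∃[ j ] (0 < entry A' i j)
    rowsNZ i with rowsNonzero (p i)
    ... | J , q with a Data.Fin.≟ J
    ... | yes refl = last' , subst (0 <_) (sym (entry-copied i (above-if-nonzero i q))) q
    ... | no a≢J with punchOut a≢J Data.Fin.≟ last'
    ...   | no ≢last' = punchOut a≢J , subst (0 <_)
            (sym (trans (entry-other i (punchOut a≢J) ≢last') (cong (entry A (p i)) (FP.punchIn-punchOut a≢J)))) q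
    ...   | yes ≡last' with toℕ (p i) <? toℕ a
    ...     | yes lt = ⊥-elim (<-irrefl (sym (trans (cong (entry A (p i))
                (trans (sym (FP.punchIn-punchOut a≢J)) (trans (cong p ≡last') p-last'))) (above-index (p i) lt))) q)
    ...     | no ≮a = punchOut a≢J , subst (0 <_)
              (sym (trans (entry-below i (punchOut a≢J) ≮a) (cong (entry A (p i)) (FP.punchIn-punchOut a≢J)))) q
    colsNZ : ∀ j → ∃[ i ] (0 < entry A' i j)
    colsNZ j with j Data.Fin.≟ last'
    ... | yes refl = proj₁ colNonzero-last' , proj₂ (proj₂ colNonzero-last')
    ... | no j≢last' with colsNonzero (p j)
    ... | I₀ , q with a Data.Fin.≟ I₀
    ... | yes refl = ⊥-elim (<-irrefl (sym (indexRow-zero (p j) (p-≢last j j≢last'))) q)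
    ... | no a≢I₀ = punchOut a≢I₀ , subst (0 <_)
          (sym (trans (entry-other (punchOut a≢I₀) j j≢last') (cong (λ z → entry A z (p j)) (FP.punchIn-punchOut a≢I₀)))) q

  p-<t : ∀ {t} i → t ≤ toℕ a → toℕ i < t → toℕ (p i) < t
  p-<t i t≤a i<t = subst (_< _) (sym (toℕ-punchIn-< a i (<-≤-trans i<t t≤a))) i<t

  splitsAt⁻ : ∀ t → t ≤ toℕ a → SplitsAt t A → SplitsAt t A'
  splitsAt⁻ t t≤a split i j i<t t≤j with j Data.Fin.≟ last'
  ... | yes refl = trans (entry-copied i (<-≤-trans (p-<t i t≤a i<t) t≤a)) (split (p i) a (p-<t i t≤a i<t) t≤a)
  ... | no j≢last' = trans (entry-other i j j≢last') (split (p i) (p j) (p-<t i t≤a i<t) (≤-trans t≤j (toℕ≤toℕ-punchIn a j)))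

  splitsAt⁺ : ∀ t → t ≤ toℕ a → SplitsAt t A' → SplitsAt t A
  splitsAt⁺ t t≤a split I J I<t t≤J = subst (λ z → entry A z J ≡ 0) (FP.punchIn-punchOut a≢I)
      (rowOf (punchOut a≢I) (subst (λ z → toℕ z < t) (sym (FP.punchIn-punchOut a≢I)) I<t))
    where
    a≢I : a ≢ I
    a≢I eq = <-irrefl (cong toℕ (sym eq)) (<-≤-trans I<t t≤a)
    rowOf : ∀ i → toℕ (p i) < t → entry A (p i) J ≡ 0
    rowOf i pi<t with toℕ-punchIn-<⇒ a i (<-≤-trans pi<t t≤a)
    ... | _ , pi≡i with a Data.Fin.≟ J
    ... | yes refl = trans (sym (entry-copied i (<-≤-trans pi<t t≤a)))
          (split i last' (subst (_< t) pi≡i pi<t) (subst (t ≤_) (sym (FP.toℕ-fromℕ k')) (≤-trans t≤a (≤-pred index<k))))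
    ... | no a≢J with J Data.Fin.≟ last
    ... | yes refl = above-index (p i) (<-≤-trans pi<t t≤a)
    ... | no J≢last = subst (λ z → entry A (p i) z ≡ 0) (FP.punchIn-punchOut a≢J)
          (trans (sym (entry-other i (punchOut a≢J) ≢last'))
            (split i (punchOut a≢J) (subst (_< t) pi≡i pi<t)
               (≤toℕ-punchIn⇒≤toℕ a (punchOut a≢J) t≤a (subst (λ z → t ≤ toℕ z) (sym (FP.punchIn-punchOut a≢J)) t≤J))))
      where
      ≢last' : punchOut a≢J ≢ last'
      ≢last' eq = J≢last (trans (sym (FP.punchIn-punchOut a≢J)) (trans (cong p eq) p-last'))

  module _ (x : List ℕ) (C : Correspondence x k' A') where
    open Correspondence C
    open CorrespondenceFacts A' isInt C

    index'<a : toℕ (indexFin A') < toℕ a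
    index'<a with colNonzero-last'
    ... | i , pi<a , q with toℕ i <? toℕ (indexFin A')
    ... | yes i<b = ⊥-elim (<-irrefl (sym (trans (sym (lookup-lastCol A' i)) (lookup-firstPos-< (lastCol A') i i<b))) q)
    ... | no i≮b = ≤-<-trans (≮⇒≥ i≮b) (proj₁ (toℕ-punchIn-<⇒ a i pi<a))

    hat-x∷ʳa : hat (x ∷ʳ toℕ a) ≡ map (bump (toℕ a)) (hat x) ∷ʳ toℕ a
    hat-x∷ʳa = trans (hat-∷ʳ-index (toℕ a)) (cong (_∷ʳ toℕ a) (if-< _ _ index'<a))

    multiplicity-punchIn : ∀ e → qSum (hat x) e ≡ (if e <ᵇ toℕ a then coeff (rowSum A) e else coeff (rowSum A) (suc e))
    multiplicity-punchIn e = trans (multiplicity e) (trans (coeff-cong rowSum-rem3 e) (coeff-punchIn (rowSum A) a e))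

    multiplicity-∷ʳ : ∀ e → bumpPoly (toℕ a) (qSum (hat x)) e + δ (toℕ a) e ≡ coeff (rowSum A) e
    multiplicity-∷ʳ e with <-cmp e (toℕ a)
    ... | tri< e<a _ _ = trans (cong₂ _+_ (trans (if-< _ _ e<a) (trans (multiplicity-punchIn e) (if-< _ _ e<a)))
                           (δ-≢ (λ q → <-irrefl (sym q) e<a))) (+-identityʳ _)
    ... | tri≈ _ refl _ = trans (cong₂ _+_ (trans (if-≮ _ _ {e} {e} (<-irrefl refl)) (if-≡ _ _ {e} refl)) (δ-refl e))
                            (sym (trans (coeff-toℕ (rowSum A) a) rowSum-index≡1))
    multiplicity-∷ʳ (suc e) | tri> _ _ a<e = trans (cong₂ _+_
        (trans (if-≮ _ _ (<⇒≯ a<e)) (trans (if-≢ _ _ (λ q → <-irrefl (sym q) a<e))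
          (trans (multiplicity-punchIn e) (if-≮ _ _ (λ q → <⇒≱ q (≤-pred a<e))))))
        (δ-≢ (λ q → <-irrefl q a<e))) (+-identityʳ _)

    lastCol-shift : ∀ e → toℕ a ≤ e → coeff (λ i → entry A' i last') e ≡ coeff (λ i → entry A i last) (suc e)
    lastCol-shift e a≤e with e <? k
    ... | no e≮k = trans (coeff-≥ _ e (≮⇒≥ e≮k)) (sym (coeff-≥ (λ i → entry A i last) (suc e) (s≤s (≮⇒≥ e≮k))))
    ... | yes e<k with fromℕ< e<k | FP.toℕ-fromℕ< e<k
    ... | i | refl = begin
      coeff (λ i → entry A' i last') (toℕ i) ≡⟨ coeff-toℕ _ i ⟩
      entry A' i last'                       ≡⟨ entry-below i last' ≮a ⟩
      entry A (p i) (p last')                ≡⟨ cong (entry A (p i)) p-last' ⟩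
      entry A (p i) last                     ≡⟨ coeff-toℕ (λ i → entry A i last) (p i) ⟨
      coeff (λ i → entry A i last) (toℕ (p i)) ≡⟨ cong (coeff (λ i → entry A i last)) (toℕ-punchIn-≮ a i ≮a) ⟩
      coeff (λ i → entry A i last) (suc (toℕ i)) ∎
      where
      open ≡-Reasoning
      ≮a : ¬ toℕ (p i) < toℕ a
      ≮a q = <⇒≱ q (≤-trans a≤e (toℕ≤toℕ-punchIn a i))

    rmaxMultiplicity-∷ʳ : ∀ e → (if e <ᵇ toℕ a then 0 else bumpPoly (toℕ a) (qSum (rmaxValues (hat x))) e) + δ (toℕ a) e
                               ≡ coeff (λ i → entry A i last) e
    rmaxMultiplicity-∷ʳ e with <-cmp e (toℕ a)
    ... | tri< e<a _ _ with fromℕ< (<-trans e<a (FP.toℕ<n a)) | FP.toℕ-fromℕ< (<-trans e<a (FP.toℕ<n a))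
    ... | i | refl = trans (cong₂ _+_ (if-< _ _ e<a) (δ-≢ (λ q → <-irrefl (sym q) e<a)))
                           (sym (trans (coeff-toℕ _ i) (above-index i e<a)))
    rmaxMultiplicity-∷ʳ e | tri≈ _ refl _ =
      trans (cong₂ _+_ (trans (if-≮ _ _ {e} {e} (<-irrefl refl)) (trans (if-≮ _ _ {e} {e} (<-irrefl refl)) (if-≡ _ _ {e} refl)))
                       (δ-refl e))
            (sym (trans (coeff-toℕ _ a) val≡1))
    rmaxMultiplicity-∷ʳ (suc e) | tri> _ _ a<e = trans (cong₂ _+_
        (trans (if-≮ _ _ (<⇒≯ a<e)) (trans (if-≮ _ _ (<⇒≯ a<e)) (trans (if-≢ _ _ (λ q → <-irrefl (sym q) a<e))
          (trans (rmaxMultiplicity e) (lastCol-shift e (≤-pred a<e))))))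
        (δ-≢ (λ q → <-irrefl q a<e))) (+-identityʳ _)

    t≤a⇒t≤k' : ∀ {t} → t ≤ toℕ a → t ≤ k'
    t≤a⇒t≤k' t≤a = ≤-trans t≤a (≤-pred index<k)

    cut⇒split-step : ∀ t → 0 < t → t ≤ k → CutAt t (hat (x ∷ʳ toℕ a)) → SplitsAt t A
    cut⇒split-step t 0<t t≤k cut with t ≤? toℕ a
    ... | yes t≤a = splitsAt⁺ t t≤a (cut⇒split t 0<t (t≤a⇒t≤k' t≤a)
          (CutAt-map-bump⁻ t (toℕ a) (hat x) t≤a
            (CutAt-++⁻ˡ t (map (bump (toℕ a)) (hat x)) (toℕ a ∷ []) (subst (CutAt t) hat-x∷ʳa cut))))
    ... | no t≰a = ⊥-elim (∈⇒¬All< (map (bump (toℕ a)) (hat x)) k∈ t≤k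
          (CutAt-∷ʳ⁻ t (map (bump (toℕ a)) (hat x)) (toℕ a) (subst (CutAt t) hat-x∷ʳa cut) (≰⇒> t≰a)))
      where
      k∈ : k ∈ map (bump (toℕ a)) (hat x)
      k∈ = subst (_∈ map (bump (toℕ a)) (hat x)) (bump-≥ (≤-pred index<k)) (∈-map⁺ (bump (toℕ a)) (hat-values k' (n<1+n k')))

    split⇒cut-step : ∀ t → 0 < t → t ≤ k → SplitsAt t A → CutAt t (hat (x ∷ʳ toℕ a))
    split⇒cut-step t 0<t t≤k split with t ≤? toℕ a
    ... | yes t≤a = subst (CutAt t) (sym hat-x∷ʳa) (CutAt-∷ʳ t (map (bump (toℕ a)) (hat x)) (toℕ a)
          (CutAt-map-bump⁺ t (toℕ a) (hat x) t≤a (split⇒cut t 0<t (t≤a⇒t≤k' t≤a) (splitsAt⁻ t t≤a split))) t≤a)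
    ... | no t≰a = ⊥-elim (<-irrefl (sym (split a last (≰⇒> t≰a) (subst (t ≤_) (sym toℕ-last) t≤k))) val-pos)

    correspondence : Correspondence (x ∷ʳ toℕ a) k A
    correspondence = record
      { prefix = x
      ; x≡prefix∷ʳindex = refl
      ; zeros≡ = trans (zeros-∷ʳ x (toℕ a)) (trans (cong₂ _+_ zeros≡ (δ-≢ (λ q → <-irrefl (sym q) 0<index)))
          (trans (+-identityʳ _) (trans (rowSum-rem3 fzero) (cong (rowSum A) p-zero))))
      ; asc≡ = trans (asc-∷ʳ-index (toℕ a)) (trans (cong (k' +_) (if-< 1 0 index'<a)) (+-comm k' 1))
      ; multiplicity = λ e → trans (cong (λ z → qSum z e) hat-x∷ʳa) (trans (qSum-∷ʳ (map (bump (toℕ a)) (hat x)) (toℕ a) e)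
          (trans (cong (_+ δ (toℕ a) e) (qSum-map-bump (toℕ a) (hat x) e)) (multiplicity-∷ʳ e)))
      ; rmaxMultiplicity = λ e → trans (cong (λ z → qSum (rmaxValues z) e) hat-x∷ʳa)
          (trans (qSum-rmaxValues-∷ʳ (map (bump (toℕ a)) (hat x)) (toℕ a) e)
            (trans (cong (λ z → (if e <ᵇ toℕ a then 0 else z) + δ (toℕ a) e)
                     (trans (cong (λ z → qSum z e) (rmaxValues-map-bump (toℕ a) (hat x)))
                            (qSum-map-bump (toℕ a) (rmaxValues (hat x)) e)))
                   (rmaxMultiplicity-∷ʳ e)))
      ; cut⇒split = cut⇒split-step
      ; split⇒cut = split⇒cut-step }
      where
      p-zero : p fzero ≡ fzero
      p-zero = FP.toℕ-injective (toℕ-punchIn-< a fzero 0<index)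

data RemovalCase : ∀ {k} → Mat (suc k) → Set where
  viaRem1 : ∀ {k} {A : Mat (suc k)} → 1 < val A ⊎ val A < rowSum A (indexFin A) →
    removal A ≡ (suc k , rem1 A) → RemovalCase A
  viaRem2 : ∀ {k'} {A : Mat (suc (suc k'))} → toℕ (indexFin A) ≡ suc k' → val A ≡ 1 →
    removal A ≡ (suc k' , rem2 A) → RemovalCase A
  viaRem3 : ∀ {k'} {A : Mat (suc (suc k'))} → toℕ (indexFin A) < suc k' → val A ≡ 1 →
    rowSum A (indexFin A) ≤ 1 → removal A ≡ (suc k' , rem3 A) → RemovalCase A

removal-if : ∀ {k} (A : Mat (suc k)) {g v i r e} →
  (1 <ᵇ val A) ≡ g → (val A ≡ᵇ 1) ≡ v → (toℕ (indexFin A) <ᵇ k) ≡ i →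
  (val A <ᵇ rowSum A (indexFin A)) ≡ r → (toℕ (indexFin A) ≡ᵇ k) ≡ e →
  removal A ≡ (if g ∨ (v ∧ i ∧ r) then (suc k , rem1 A) else (if e then (k , rem2 A) else (k , rem3 A)))
removal-if A refl refl refl refl refl = refl

removalCase : ∀ {m k} (A : Mat (suc k)) → IsInt (suc (suc m)) A → RemovalCase A
removalCase {m} {k} A I with 1 <? val A
... | yes 1<val = viaRem1 (inj₁ 1<val) (removal-if A (<ᵇ-true 1<val) refl refl refl refl)
... | no val≯1 = withVal1 k A I (≤-antisym (≮⇒≥ val≯1) (IntFacts.val-pos A I)) (<ᵇ-false val≯1)
  where
  withVal1 : ∀ k (A : Mat (suc k)) → IsInt (suc (suc m)) A → val A ≡ 1 → (1 <ᵇ val A) ≡ false → RemovalCase A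
  withVal1 zero ((v ∷v []v) ∷v []v) I val≡1 _ = ⊥-elim (1+n≢0 (suc-injective
    (trans (sym (IsInt.sumIsN I)) (trans (+-identityʳ (v + 0)) (trans (+-identityʳ v) val≡1)))))
  withVal1 (suc k') A I val≡1 ≯1 with toℕ (indexFin A) <? suc k'
  ... | no index≮k = viaRem2 index≡k val≡1
        (removal-if A ≯1 (≡ᵇ-true val≡1) (<ᵇ-false index≮k) refl (≡ᵇ-true index≡k))
    where
    index≡k : toℕ (indexFin A) ≡ suc k'
    index≡k = ≤-antisym (≤-pred (FP.toℕ<n (indexFin A))) (≮⇒≥ index≮k)
  ... | yes index<k with val A <? rowSum A (indexFin A)
  ...   | yes val<row = viaRem1 (inj₂ val<row)
          (removal-if A ≯1 (≡ᵇ-true val≡1) (<ᵇ-true index<k) (<ᵇ-true val<row) refl)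
  ...   | no val≮row = viaRem3 index<k val≡1 (subst (rowSum A (indexFin A) ≤_) val≡1 (≮⇒≥ val≮row))
          (removal-if A ≯1 (≡ᵇ-true val≡1) (<ᵇ-true index<k) (<ᵇ-false val≮row) (≡ᵇ-false (<⇒≢ index<k)))

Γ-removal : ∀ m {k} (A : Mat (suc k)) {d'} {A' : Mat d'} → removal A ≡ (d' , A') →
  Γ (suc (suc m)) A ≡ Γ (suc m) A' ∷ʳ toℕ (indexFin A)
Γ-removal m A eq = cong (λ r → gammaAux (suc m) (proj₁ r) (proj₂ r) ∷ʳ toℕ (indexFin A)) eq

correspondence : ∀ m k (A : Mat (suc k)) → IsInt (suc m) A → Correspondence (Γ (suc m) A) k A
correspondence zero zero ((v ∷v []v) ∷v []v) I = record
  { prefix = []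
  ; x≡prefix∷ʳindex = refl
  ; zeros≡ = sym (trans (+-identityʳ v) v≡1)
  ; asc≡ = refl
  ; multiplicity = singleEntry (trans (+-identityʳ v) v≡1)
  ; rmaxMultiplicity = singleEntry v≡1
  ; cut⇒split = λ t 0<t t≤0 → ⊥-elim (<⇒≱ 0<t t≤0)
  ; split⇒cut = λ t 0<t t≤0 → ⊥-elim (<⇒≱ 0<t t≤0) }
  where
  v≡1 : v ≡ 1
  v≡1 = trans (sym (trans (+-identityʳ (v + 0)) (+-identityʳ v))) (IsInt.sumIsN I)
  singleEntry : ∀ {f : Fin 1 → ℕ} → f fzero ≡ 1 → ∀ e → qSum (0 ∷ []) e ≡ coeff f e
  singleEntry f0≡1 zero = sym f0≡1
  singleEntry f0≡1 (suc e) = refl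
correspondence zero (suc k) A I = ⊥-elim (<⇒≱ (s≤s (s≤s z≤n)) (IntFacts.dim≤n A I))
correspondence (suc m) k A I with removalCase A I
... | viaRem1 cond eq = subst (λ x → Correspondence x k A) (sym (Γ-removal m A eq))
      (Rem1.correspondence A I cond _ (correspondence m k (rem1 A) (Rem1.isInt A I cond)))
... | viaRem2 {k'} index≡k val≡1 eq = subst (λ x → Correspondence x k A) (sym (Γ-removal m A eq))
      (Rem2.correspondence A I index≡k val≡1 _ (correspondence m k' (rem2 A) (Rem2.isInt A I index≡k val≡1)))
... | viaRem3 {k'} index<k val≡1 row≤1 eq = subst (λ x → Correspondence x k A) (sym (Γ-removal m A eq))
      (Rem3.correspondence A I index<k val≡1 row≤1 _ (correspondence m k' (rem3 A) (Rem3.isInt A I index<k val≡1 row≤1)))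

-- Both comp(x̂) and blocks(A) are one more than the longest chain of splits of A.

module Components {x k} (A : Mat (suc k)) {n} (I : IsInt n A) (C : Correspondence x k A) where
  open Correspondence C
  open CorrespondenceFacts A I C
  open LongestChain (λ t → SplitsAt t A) (λ t → SplitsAt? t A)
  d = suc k

  splits : List ℕ
  splits = chainBelow d

  count : ℕ
  count = suc (length splits)

  private
    inRange : ∀ {P : ℕ → Set} L → Chain d L → (∀ {t} → 0 < t → t < d → P t) → All P L
    inRange L c f = All.zipWith (λ (0<t , t<d) → f 0<t t<d) (Chain⇒All-pos L c , Chain⇒All< L c)

  oplusSum-largest : IsLargest (λ c → OplusSum c (hat x)) count
  oplusSum-largest = cuts⇒OplusSum d splits (hat x) (chainBelow-Chain d)
      (All.zipWith (λ (s , f) → f s) (chainBelow-All d ,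
        inRange splits (chainBelow-Chain d) (λ 0<t t<d → split⇒cut _ 0<t (≤-pred t<d))))
      hat-< hat-values z<s ,
    λ c os → bounded os
    where
    bounded : ∀ {c} → OplusSum c (hat x) → c ≤ count
    bounded os with OplusSum⇒cuts os
    ... | L , chain , cuts , len = subst (_≤ count) len (s≤s (chainBelow-longest d L chain'
          (All.zipWith (λ (c , f) → f c) (cuts , inRange L chain' (λ 0<t t<d → cut⇒split _ 0<t (≤-pred t<d))))))
      where
      chain' : Chain d L
      chain' = Chain-weaken L (s≤s (maxL-lub (hat x) (All.map ≤-pred hat-<))) chain

  Zero : ℕ → ℕ → Set
  Zero i j = ∀ (i' j' : Fin d) → toℕ i' ≡ i → toℕ j' ≡ j → entry A i' j' ≡ 0
  open BlockDecomposition Zero d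

  fromSplitsAt : ∀ {t} → CornerZero t → SplitsAt t A
  fromSplitsAt split i j i<t t≤j = split (toℕ i) (toℕ j) i<t t≤j (FP.toℕ<n j) i j refl refl

  toSplitsAt : ∀ {t} → SplitsAt t A → CornerZero t
  toSplitsAt {t} split i j i<t t≤j _ i' j' refl refl = split i' j' i<t t≤j

  blockDiag-largest : IsLargest (λ c → BlockDiag c A) count
  blockDiag-largest with splits⇒blocks (λ i j j<i i' j' i'≡i j'≡j → IsInt.upperTriangular I i' j' (subst₂ _<_ (sym j'≡j) (sym i'≡i) j<i))
                           splits z<s (chainBelow-Chain d) (All.map toSplitsAt (chainBelow-All d))
  ... | sz , (pos , sum≡d , separated) , len =
    (sz , len , pos , sum≡d , λ i j ne → separated (toℕ i) (toℕ j) (FP.toℕ<n i) (FP.toℕ<n j) ne i j refl refl) ,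
    λ c bd → bounded bd
    where
    bounded : ∀ {c} → BlockDiag c A → c ≤ count
    bounded (sz' , len' , pos' , sum≡d' , sep') with blocks⇒splits sz' z<s
        (pos' , sum≡d' , λ { i j _ _ ne i' j' refl refl → sep' i' j' ne })
    ... | L , chain , splitsL , len = subst (_≤ count) (trans len len')
          (s≤s (chainBelow-longest d L chain (All.map fromSplitsAt splitsL)))

rmax≡lastColSum : ∀ {x k} (A : Mat (suc k)) {n} (I : IsInt n A) → Correspondence x k A →
  rmax (hat x) ≡ lastColSum A
rmax≡lastColSum {x} {k} A I C = begin
  rmax (hat x)                                  ≡⟨ rmax≡length-rmaxValues (hat x) ⟩
  length (rmaxValues (hat x))                   ≡⟨ length≡∑qSum (suc k) _ (rmaxValues-All (hat x) hat-<) ⟩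
  ∑ {suc k} (λ i → qSum (rmaxValues (hat x)) (toℕ i)) ≡⟨ ∑-cong (λ i → trans (rmaxMultiplicity (toℕ i)) (coeff-toℕ _ i)) ⟩
  ∑ (λ i → entry A i (fromℕ k))                 ≡⟨ ∑-cong (lookup-lastCol A) ⟨
  ∑ (lookup (lastCol A))                        ≡⟨ sum≡∑ (lastCol A) ⟨
  lastColSum A ∎
  where
  open ≡-Reasoning
  open Correspondence C
  open CorrespondenceFacts A I C

mainTheorem5 : (n : ℕ) → 1 ≤ n → (d : ℕ) → (A : Mat d) → IsInt n A →
    let x = Γ n A in
    (zeros x ≡ firstRowSum A)
    × (lastOf x ≡ just (index A ∸ 1))
    × (asc x ≡ d ∸ 1)
    × (rmax (hat x) ≡ lastColSum A)
    × (∃[ m ] (IsLargest (λ k → OplusSum k (hat x)) m × IsLargest (λ k → BlockDiag k A) m))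
    × (qSum (hat x) ≈ₚ rowPoly A)
    × (qSumRmax (hat x) ≈ₚ lastColPoly A)
mainTheorem5 (suc m) _ zero []v I = ⊥-elim (0≢1+n (IsInt.sumIsN I))
mainTheorem5 (suc m) _ (suc k) A I =
  zeros≡ ,
  trans (cong lastOf x≡prefix∷ʳindex) (last-∷ʳ prefix _) ,
  asc≡ ,
  rmax≡lastColSum A I C ,
  (count , oplusSum-largest , blockDiag-largest) ,
  (λ e → trans (multiplicity e) (sym (poly-coeff (rowSum A) e))) ,
  (λ e → trans (qSumRmax≡qSum-rmaxValues (hat x) e) (trans (rmaxMultiplicity e)
     (sym (trans (poly-coeff (lookup (lastCol A)) e) (coeff-cong (lookup-lastCol A) e)))))
  where
  x = Γ (suc m) A
  C = correspondence m k A I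
  open Correspondence C
  open Components A I C
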